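{- Let $n\ge3$ and $D_n=\langle a,b\mid a^n=b^2=1,\ ab=ba^{ -1}\rangle$. (i) If $n$ is odd, then $\Gamma(D_n)$ is not Eulerian. (ii) If $n=2^\alpha$ with $\alpha\ge2$, then $\Gamma(D_n)$ is Eulerian iff $\alpha$ is odd. (iii) If $n=2^\alpha n'$ with $\alpha\ge1$ and $n'=p_1^{\alpha_1}\cdots p_k^{\alpha_k}$ odd ($p_i$ distinct primes, $\alpha_i\ge1$), then $\Gamma(D_n)$ is Eulerian iff $\alpha$ is odd and $\alpha_i$ is even for every $i\in\{1,\dots,k\}$.
   Context: For a group $G$, $\Gamma(G)$ is the simple graph whose vertices are the subgroups of $G$ other than $\{1\}$ and $G$, two distinct vertices $H,K$ being adjacent iff $HK=KH$. Following the paper's convention, a graph is called Eulerian iff every vertex has even degree. -}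

module Defs where

open import Data.Nat using (ℕ; NonZero; _+_; _∸_)
open import Data.Nat.DivMod using (_mod_)
open import Data.Fin using (Fin; toℕ)
open import Data.Fin.Subset using (Subset; _∈_; ⁅_⁆; ⊥; ⊤)
open import Data.Product using (Σ; _×_; ∃)
open import Data.List using (List; length)
open import Data.List.Relation.Unary.Unique.Propositional using (Unique)
import Data.List.Membership.Propositional as LM
open import Relation.Binary.PropositionalEquality using (_≡_; _≢_)
open import Function.Bundles using (_⇔_)
open import Data.Nat.Divisibility using (_∣_)

-- Concrete model of D_n = ⟨ a, b | a^n = b^2 = 1, ab = ba⁻¹ ⟩ (order 2n):
-- rot i  stands for a^i,  ref i  stands for a^i b   (i ∈ ℤ/nℤ).
data El (n : ℕ) : Set where
  rot : Fin n → El n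
  ref : Fin n → El n

module _ (n : ℕ) .{{_ : NonZero n}} where

  addₙ : Fin n → Fin n → Fin n
  addₙ i j = (toℕ i + toℕ j) mod n

  subₙ : Fin n → Fin n → Fin n
  subₙ i j = (toℕ i + (n ∸ toℕ j)) mod n

  -- a^i a^j = a^(i+j);  a^i · a^j b = a^(i+j) b;
  -- a^i b · a^j = a^(i-j) b;  a^i b · a^j b = a^(i-j)
  mul : El n → El n → El n
  mul (rot i) (rot j) = rot (addₙ i j)
  mul (rot i) (ref j) = ref (addₙ i j)
  mul (ref i) (rot j) = ref (subₙ i j)
  mul (ref i) (ref j) = rot (subₙ i j)

  one : El n
  one = rot (0 mod n)

  inv : El n → El n
  inv (rot i) = rot (subₙ (0 mod n) i)
  inv (ref i) = ref i

  -- A subset of D_n: (set of exponents i with a^i in it, set of i with a^i b in it)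
  Sub : Set
  Sub = Subset n × Subset n

  _∈ₛ_ : El n → Sub → Set
  rot i ∈ₛ (R Data.Product., F) = i ∈ R
  ref i ∈ₛ (R Data.Product., F) = i ∈ F

  IsSubgroup : Sub → Set
  IsSubgroup S = (one ∈ₛ S)
               × (∀ x y → x ∈ₛ S → y ∈ₛ S → mul x y ∈ₛ S)
               × (∀ x → x ∈ₛ S → inv x ∈ₛ S)

  trivialSub : Sub
  trivialSub = (⁅ 0 mod n ⁆ Data.Product., ⊥)

  fullSub : Sub
  fullSub = (⊤ Data.Product., ⊤)

  Vertex : Sub → Set
  Vertex S = IsSubgroup S × S ≢ trivialSub × S ≢ fullSub

  -- HK ⊆ KH
  ProdSub : Sub → Sub → Set
  ProdSub H K = ∀ h k → h ∈ₛ H → k ∈ₛ K →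
                Σ (El n) λ k' → Σ (El n) λ h' → k' ∈ₛ K × h' ∈ₛ H × mul h k ≡ mul k' h'

  Permute : Sub → Sub → Set
  Permute H K = ProdSub H K × ProdSub K H

  Adjacent : Sub → Sub → Set
  Adjacent H K = Vertex H × Vertex K × H ≢ K × Permute H K

  HasDegree : Sub → ℕ → Set
  HasDegree H d = Σ (List Sub) λ L → Unique L × length L ≡ d
                  × (∀ K → (K LM.∈ L) ⇔ Adjacent H K)

  -- Eulerian (paper's convention): every vertex has even degree
  Eulerian : Set
  Eulerian = ∀ H → Vertex H → ∃ λ d → HasDegree H d × 2 ∣ d

module Submission where

open import Defs
open import Data.Nat using (ℕ; NonZero; _≤_; _^_; _*_; suc)
open import Data.Nat.Divisibility using (_∣_)
open import Data.Nat.Primality using (Prime)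
open import Data.Product using (_×_)
open import Relation.Binary.PropositionalEquality using (_≡_)
open import Relation.Nullary using (¬_)
open import Function.Bundles using (_⇔_)

open import Data.Nat using (s≤s; z≤n)
open import Data.Nat.Properties using (≤-trans; *-identityˡ; *-identityʳ)
open import Data.Bool using (true; false; _∧_)
open import Data.Product using (_,_; proj₁)
open import Data.Empty using (⊥-elim)
open import Function.Bundles using (mk⇔; Equivalence)
open import Function.Base using (_∘_)
open import Relation.Nullary using (Dec; yes; no; does)
open import Relation.Binary.PropositionalEquality using (refl; sym; trans)
open Equivalence using (to; from)

-- D_n has exactly one subgroup ⟨a^d⟩ and d subgroups ⟨a^d, a^j b⟩ (j < d) for
-- every divisor d of n, hence Σ_{d ∣ n} (1 + d) subgroups (SubgroupList).
-- Fix a vertex H.  The vertices other than H that do not permute with H come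
-- in pairs: if H consists of rotations it is normal and permutes with every
-- subgroup; otherwise conjugation by a reflection h ∈ H is a fixed-point-free
-- involution on them, because a subgroup normalised by h permutes with H
-- (Permutability).  So deg H ≡ #subgroups - 3 (mod 2) for every vertex, and
-- Γ(D_n) is Eulerian iff Σ_{d ∣ n} (1 + d) is odd (Degrees).  Writing
-- n = 2^α n' with n' odd, this sum is τ(n) + τ(n') modulo 2, and τ(N) is odd
-- iff N is a square (Divisors); so it is odd iff α is odd and n' is a square
-- (DivisorSum), and n' is a square iff all its prime exponents are even
-- (Valuations).

-- Parity of natural numbers, as a Boolean.
module Parity where
  open import Data.Nat using (ℕ; zero; suc; _+_; _*_; NonZero; ≢-nonZero)
  open import Data.Nat.Properties using (+-suc; *-comm; +-identityʳ)
  open import Data.Nat.Divisibility using (_∣_; divides; _∣0)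
  open import Data.Bool using (Bool; true; false; not; _xor_; _∧_)
  open import Data.Bool.Properties using (not-involutive; xor-same)
  open import Data.Product using (∃; _,_)
  open import Data.Sum using (_⊎_; inj₁; inj₂)
  open import Relation.Nullary using (¬_)
  open import Relation.Binary.PropositionalEquality using (_≡_; refl; sym; trans; cong)

  parity : ℕ → Bool
  parity zero = false
  parity (suc n) = not (parity n)

  parity-+ : ∀ a b → parity (a + b) ≡ parity a xor parity b
  parity-+ zero b = refl
  parity-+ (suc a) b rewrite parity-+ a b with parity a
  ... | true = not-involutive (parity b)
  ... | false = refl

  parity-* : ∀ a b → parity (a * b) ≡ parity a ∧ parity b
  parity-* zero b = refl
  parity-* (suc a) b rewrite parity-+ b (a * b) | parity-* a b with parity a | parity b
  ... | true | true = refl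
  ... | true | false = refl
  ... | false | true = refl
  ... | false | false = refl

  parity-double : ∀ k → parity (k + k) ≡ false
  parity-double k = trans (parity-+ k k) (xor-same (parity k))

  parity-2+ : ∀ k → parity (suc (suc k)) ≡ parity k
  parity-2+ k = not-involutive (parity k)

  halve : ∀ x → (∃ λ k → x ≡ k + k) ⊎ (∃ λ k → x ≡ suc (k + k))
  halve zero = inj₁ (0 , refl)
  halve (suc x) with halve x
  ... | inj₁ (k , e) = inj₂ (k , cong suc e)
  ... | inj₂ (k , e) = inj₁ (suc k , cong suc (trans e (sym (+-suc k k))))

  2∣⇒even : ∀ {x} → 2 ∣ x → parity x ≡ false
  2∣⇒even (divides q refl) rewrite parity-* q 2 with parity q
  ... | true = refl
  ... | false = refl

  even⇒2∣ : ∀ x → parity x ≡ false → 2 ∣ x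
  even⇒2∣ x p with halve x
  ... | inj₁ (k , e) = divides k (trans e (trans (cong (k +_) (sym (+-identityʳ k))) (*-comm 2 k)))
  ... | inj₂ (k , refl) with () ← trans (sym p) (cong not (parity-double k))

  ¬2∣⇒odd : ∀ x → ¬ (2 ∣ x) → parity x ≡ true
  ¬2∣⇒odd x h with parity x in e
  ... | true = refl
  ... | false with () ← h (even⇒2∣ x e)

  odd⇒¬2∣ : ∀ {x} → parity x ≡ true → ¬ (2 ∣ x)
  odd⇒¬2∣ p d with () ← trans (sym p) (2∣⇒even d)

  ¬2∣⇒nonZero : ∀ {x} → ¬ (2 ∣ x) → NonZero x
  ¬2∣⇒nonZero x-odd = ≢-nonZero (λ { refl → x-odd (2 ∣0) })

-- Counting duplicate-free lists: equal member sets give equal lengths, and a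
-- fixed-point-free involution forces even length.
module DistinctLists where
  open import Data.Nat using (suc; _+_; _≤_)
  open import Data.Nat.Properties using (≤-refl; ≤-trans; ≤-pred; n≤1+n; +-suc)
  open import Data.Bool using (false)
  open import Data.List using (List; []; _∷_; _++_; length; filter)
  open import Data.List.Membership.Propositional using (_∈_; _∉_)
  open import Data.List.Membership.Propositional.Properties using (∈-∃++)
  open import Data.List.Membership.Propositional.Properties.WithK using (unique∧set⇒bag)
  open import Data.List.Relation.Binary.BagAndSetEquality using (∼bag⇒↭)
  open import Data.List.Relation.Binary.Permutation.Propositional using (_↭_; ↭-sym; ↭-prep; ↭⇒↭ₛ)
  open import Data.List.Relation.Binary.Permutation.Propositional.Properties using (↭-length; ∈-resp-↭; shift)
  open import Data.List.Relation.Unary.Any using (here; there)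
  open import Data.List.Relation.Unary.AllPairs using (_∷_)
  open import Data.List.Relation.Unary.Unique.Propositional using (Unique)
  open import Data.Product using (_,_; _×_)
  open import Data.Empty using (⊥-elim)
  import Data.List.Relation.Unary.All as All
  open import Relation.Nullary using (¬?; yes; no)
  open import Relation.Unary using (Decidable)
  open import Relation.Binary.PropositionalEquality using (_≡_; _≢_; refl; sym; trans; cong; subst; setoid; module ≡-Reasoning)
  open import Function.Bundles using (mk⇔)
  open Parity using (parity; parity-2+)

  same-length : ∀ {A : Set} {xs ys : List A} → Unique xs → Unique ys →
    (∀ {x} → x ∈ xs → x ∈ ys) → (∀ {x} → x ∈ ys → x ∈ xs) → length xs ≡ length ys
  same-length u v f g = ↭-length (∼bag⇒↭ (unique∧set⇒bag u v (mk⇔ f g)))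

  length-partition : ∀ {A : Set} {P : A → Set} (P? : Decidable P) (xs : List A) →
    length (filter P? xs) + length (filter (λ x → ¬? (P? x)) xs) ≡ length xs
  length-partition P? [] = refl
  length-partition P? (x ∷ xs) with P? x
  ... | yes _ = cong suc (length-partition P? xs)
  ... | no _ = trans (+-suc _ _) (cong suc (length-partition P? xs))

  unique-resp-↭ : ∀ {A : Set} {xs ys : List A} → xs ↭ ys → Unique xs → Unique ys
  unique-resp-↭ {A} p = Unique-resp-↭ (↭⇒↭ₛ p)
    where open import Data.List.Relation.Binary.Permutation.Setoid.Properties (setoid A) using (Unique-resp-↭)

  module _ {A : Set} (σ : A → A) where

    record PairsOff (xs : List A) : Set where
      field
        involutive : ∀ {x} → x ∈ xs → σ (σ x) ≡ x
        closed     : ∀ {x} → x ∈ xs → σ x ∈ xs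
        no-fixed   : ∀ {x} → x ∈ xs → σ x ≢ x
    open PairsOff

    private
      remove-pair : ∀ {x} us vs → Unique (x ∷ us ++ σ x ∷ vs) → PairsOff (x ∷ us ++ σ x ∷ vs) →
        Unique (us ++ vs) × PairsOff (us ++ vs)
      remove-pair {x} us vs u P = uys , record
        { involutive = λ p → involutive P (shrink p)
        ; closed = λ p → stay p (∈-resp-↭ perm (closed P (shrink p)))
        ; no-fixed = λ p → no-fixed P (shrink p) }
        where
          perm : x ∷ us ++ σ x ∷ vs ↭ x ∷ σ x ∷ us ++ vs
          perm = ↭-prep x (shift (σ x) us vs)
          u′ : Unique (x ∷ σ x ∷ us ++ vs)
          u′ = unique-resp-↭ perm u
          uys : Unique (us ++ vs)
          uys with _ ∷ _ ∷ w ← u′ = w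
          shrink : ∀ {y} → y ∈ us ++ vs → y ∈ x ∷ us ++ σ x ∷ vs
          shrink p = ∈-resp-↭ (↭-sym perm) (there (there p))
          x∉ : x ∉ us ++ vs
          x∉ p with x≢ ∷ _ ← u′ = All.lookup x≢ (there p) refl
          σx∉ : σ x ∉ us ++ vs
          σx∉ p with _ ∷ σx≢ ∷ _ ← u′ = All.lookup σx≢ p refl
          -- σ y ≡ x would give y ≡ σ x, and σ y ≡ σ x would give y ≡ x.
          stay : ∀ {y} → y ∈ us ++ vs → σ y ∈ x ∷ σ x ∷ us ++ vs → σ y ∈ us ++ vs
          stay p (here σy≡x) =
            ⊥-elim (σx∉ (subst (_∈ us ++ vs) (trans (sym (involutive P (shrink p))) (cong σ σy≡x)) p))
          stay p (there (here σy≡σx)) =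
            ⊥-elim (x∉ (subst (_∈ us ++ vs) (trans (sym (involutive P (shrink p)))
                                            (trans (cong σ σy≡σx) (involutive P (here refl)))) p))
          stay p (there (there q)) = q

    pairs-off⇒even : ∀ xs → Unique xs → PairsOff xs → parity (length xs) ≡ false
    pairs-off⇒even xs = go (length xs) xs ≤-refl
      where
        go : ∀ k xs → length xs ≤ k → Unique xs → PairsOff xs → parity (length xs) ≡ false
        go k [] _ _ _ = refl
        go k (x ∷ rest) le u P with closed P (here refl)
        ... | here e = ⊥-elim (no-fixed P (here refl) e)
        ... | there σx∈ with ∈-∃++ σx∈
        ...   | us , vs , refl with suc k′ ← k | remove-pair us vs u P
        ...     | uys , Pys = begin
          parity (length (x ∷ us ++ σ x ∷ vs))  ≡⟨ cong parity (↭-length (↭-prep x (shift (σ x) us vs))) ⟩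
          parity (suc (suc (length (us ++ vs)))) ≡⟨ parity-2+ (length (us ++ vs)) ⟩
          parity (length (us ++ vs))             ≡⟨ go k′ (us ++ vs) shorter uys Pys ⟩
          false                                  ∎
          where
            open ≡-Reasoning
            shorter : length (us ++ vs) ≤ k′
            shorter = ≤-pred (≤-trans (n≤1+n _) (subst (_≤ suc k′) (↭-length (↭-prep x (shift (σ x) us vs))) le))

-- Divisors and squares: the number of divisors of N is odd iff N is a square.
module Divisors where
  open import Data.Nat using (ℕ; zero; suc; _+_; _*_; _≤_; _<_; z≤n; s≤s; NonZero; _/_; ≢-nonZero⁻¹; _≟_)
  open import Data.Nat.Properties using (<-cmp; <-irrefl; *-mono-<; m≤m*n; *-comm; *-cancelˡ-≡; *-cancelʳ-≡)
  open import Data.Nat.DivMod using (m*[n/m]≡n)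
  open import Data.Nat.Divisibility using (_∣_; divides; _∣?_; ∣⇒≤; 0∣⇒≡0)
  open import Data.Bool using (true; false; _xor_; if_then_else_)
  open import Data.List using (List; length; filter; upTo)
  open import Data.List.Membership.Propositional using (_∈_)
  open import Data.List.Membership.Propositional.Properties using (∈-filter⁺; ∈-filter⁻; ∈-upTo⁺)
  open import Data.List.Relation.Unary.Any using (here)
  open import Data.List.Relation.Unary.All using ([])
  open import Data.List.Relation.Unary.AllPairs using ([]; _∷_)
  open import Data.List.Relation.Unary.Unique.Propositional using (Unique)
  open import Data.List.Relation.Unary.Unique.Propositional.Properties using (filter⁺; upTo⁺)
  open import Data.Product using (∃; _×_; _,_; proj₁; proj₂)
  open import Data.Empty using (⊥-elim)
  open import Relation.Binary using (tri<; tri≈; tri>)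
  open import Data.Fin using (Fin; toℕ; fromℕ<)
  open import Data.Fin.Properties using (any?; toℕ-fromℕ<)
  open import Relation.Nullary.Decidable using (map′)
  open import Relation.Nullary using (¬_; Dec; yes; no; ¬?; does)
  open import Relation.Binary.PropositionalEquality using (_≡_; refl; sym; trans; cong; cong₂; subst; module ≡-Reasoning)
  open Parity using (parity; parity-+)
  open DistinctLists using (same-length; length-partition; pairs-off⇒even)

  Square : ℕ → Set
  Square N = ∃ λ m → m * m ≡ N

  square-root-unique : ∀ {a b} → a * a ≡ b * b → a ≡ b
  square-root-unique {a} {b} e with <-cmp a b
  ... | tri≈ _ p _ = p
  ... | tri< p _ _ = ⊥-elim (<-irrefl e (*-mono-< p p))
  ... | tri> _ _ p = ⊥-elim (<-irrefl (sym e) (*-mono-< p p))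

  root≤ : ∀ {N} m → m * m ≡ N → m ≤ N
  root≤ zero e = z≤n
  root≤ (suc m) e = subst (suc m ≤_) e (m≤m*n (suc m) (suc m))

  small-root : ∀ {N} → Square N → ∃ λ (i : Fin (suc N)) → toℕ i * toℕ i ≡ N
  small-root {N} (m , e) = fromℕ< m<1+N , subst (λ k → k * k ≡ N) (sym (toℕ-fromℕ< m<1+N)) e
    where
      m<1+N : m < suc N
      m<1+N = s≤s (root≤ m e)

  -- Squareness is decidable.  (Opaque, so that does (square? N) is a single
  -- term to case on.)
  opaque
    square? : ∀ N → Dec (Square N)
    square? N = map′ (λ (i , e) → toℕ i , e) small-root (any? λ (i : Fin (suc N)) → toℕ i * toℕ i ≟ N)

  divisors : ℕ → List ℕ
  divisors N = filter (_∣? N) (upTo (suc N))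

  divisors-unique : ∀ N → Unique (divisors N)
  divisors-unique N = filter⁺ (_∣? N) (upTo⁺ (suc N))

  ∈-divisors⁺ : ∀ {N e} .{{_ : NonZero N}} → e ∣ N → e ∈ divisors N
  ∈-divisors⁺ {N} d = ∈-filter⁺ (_∣? N) (∈-upTo⁺ {suc N} (s≤s (∣⇒≤ d))) d

  ∈-divisors⁻ : ∀ {N e} → e ∈ divisors N → e ∣ N
  ∈-divisors⁻ {N} p = proj₂ (∈-filter⁻ (_∣? N) {xs = upTo (suc N)} p)

  divisor-nonZero : ∀ {N e} → .{{_ : NonZero N}} → e ∣ N → NonZero e
  divisor-nonZero {N} {zero} d = ⊥-elim (≢-nonZero⁻¹ N (0∣⇒≡0 d))
  divisor-nonZero {N} {suc e} d = _

  -- The complementary divisor N / e (defined without a NonZero e argument).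
  complement : ℕ → ℕ → ℕ
  complement N zero = 0
  complement N (suc e) = N / suc e

  module _ (N : ℕ) .{{_ : NonZero N}} where

    complement-* : ∀ e → e ∣ N → e * complement N e ≡ N
    complement-* zero d = ⊥-elim (≢-nonZero⁻¹ N (0∣⇒≡0 d))
    complement-* (suc e) d = m*[n/m]≡n d

    complement-∣ : ∀ e → e ∣ N → complement N e ∣ N
    complement-∣ e d = divides e (sym (complement-* e d))

    complement-involutive : ∀ e → e ∣ N → complement N (complement N e) ≡ e
    complement-involutive e d =
      *-cancelˡ-≡ (complement N f) e f {{divisor-nonZero (complement-∣ e d)}}
        (trans (complement-* f (complement-∣ e d)) (trans (sym (complement-* e d)) (*-comm e f)))
      where f = complement N e

    complement-fixed : ∀ e → e ∣ N → complement N e ≡ e → e * e ≡ N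
    complement-fixed e d eq = trans (cong (e *_) (sym eq)) (complement-* e d)

    complement-square : ∀ e → e ∣ N → complement N e * complement N e ≡ N → e * e ≡ N
    complement-square e d h = trans (cong (e *_) e≡f) (complement-* e d)
      where
        f : ℕ
        f = complement N e
        e≡f : e ≡ f
        e≡f = *-cancelʳ-≡ e f f {{divisor-nonZero (complement-∣ e d)}} (trans (complement-* e d) (sym h))

    -- The number of divisors of N is odd exactly when N is a square: the
    -- divisors e with e * e ≢ N are paired off by e ↦ N / e, and at most one
    -- divisor (the square root) remains.
    divisor-count-parity : parity (length (divisors N)) ≡ does (square? N)
    divisor-count-parity = begin
        parity (length D)                        ≡⟨ cong parity (sym (length-partition root? D)) ⟩
        parity (length roots + length others)    ≡⟨ parity-+ (length roots) (length others) ⟩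
        parity (length roots) xor parity (length others)
                                                 ≡⟨ cong₂ _xor_ (cong parity roots-length) others-even ⟩
        parity (if does (square? N) then 1 else 0) xor false
                                                 ≡⟨ indicator (does (square? N)) ⟩
        does (square? N)                         ∎
      where
        open ≡-Reasoning
        D : List ℕ
        D = divisors N
        root? : ∀ e → Dec (e * e ≡ N)
        root? e = e * e ≟ N
        roots others : List ℕ
        roots = filter root? D
        others = filter (λ e → ¬? (root? e)) D

        others-member : ∀ {e} → e ∈ others → e ∣ N × ¬ (e * e ≡ N)
        others-member p with q , nr ← ∈-filter⁻ (λ e → ¬? (root? e)) {xs = D} p = ∈-divisors⁻ q , nr

        others-even : parity (length others) ≡ false
        others-even = pairs-off⇒even (complement N) others
          (filter⁺ (λ e → ¬? (root? e)) {D} (divisors-unique N))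
          record
            { involutive = λ p → complement-involutive _ (proj₁ (others-member p))
            ; closed = λ {e} p → let (d , nr) = others-member p in
                ∈-filter⁺ (λ e → ¬? (root? e)) (∈-divisors⁺ (complement-∣ e d)) (λ h → nr (complement-square e d h))
            ; no-fixed = λ {e} p eq → let (d , nr) = others-member p in nr (complement-fixed e d eq) }

        roots-length : length roots ≡ (if does (square? N) then 1 else 0)
        roots-length with square? N
        ... | yes (m , me) = same-length (filter⁺ root? {D} (divisors-unique N)) ([] ∷ [])
              (λ p → here (square-root-unique (trans (proj₂ (∈-filter⁻ root? {xs = D} p)) (sym me))))
              (λ { (here refl) → ∈-filter⁺ root? (∈-divisors⁺ (divides m (sym me))) me })
        ... | no ns = same-length (filter⁺ root? {D} (divisors-unique N)) []
              (λ {x} p → ⊥-elim (ns (x , proj₂ (∈-filter⁻ root? {xs = D} p)))) (λ ())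

        indicator : ∀ b → parity (if b then 1 else 0) xor false ≡ b
        indicator true = refl
        indicator false = refl

-- Prime exponents: N ≠ 0 is a square iff every prime occurs in it with even
-- exponent.
module Valuations where
  open import Data.Nat using (ℕ; zero; suc; _+_; _*_; _^_; _∸_; _≤_; _<_; z≤n; s≤s; NonZero; ≢-nonZero; ≢-nonZero⁻¹; nonTrivial⇒n>1)
  open import Data.Nat.Properties using (_≟_; m∸n+n≡m; ^-distribˡ-+-*; <-cmp; ≤-refl; ≤-pred; ≤-trans; *-identityʳ; m<m*n; *-comm; m^n≢0; +-comm; ^-monoʳ-<; +-identityʳ; <-irrefl; ^-monoʳ-≤; *-assoc)
  open import Data.Nat.Divisibility using (_∣_; divides; _∣?_; ∣-trans; ∣-refl; *-cancelˡ-∣; *-pres-∣; >⇒∤)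
  open import Data.Nat.Primality using (Prime; euclidsLemma; prime⇒nonTrivial; prime⇒irreducible; prime⇒nonZero)
  open import Data.Nat.Primality.Factorisation using (factorise)
  open import Data.Nat.ListAction using (product)
  open import Data.List using ([]; _∷_)
  open import Data.List.Relation.Unary.All using (_∷_)
  open import Data.Product using (∃; _×_; _,_; proj₁; proj₂)
  open import Data.Sum using (inj₁; inj₂)
  open import Data.Empty using (⊥-elim)
  open import Relation.Binary using (tri<; tri≈; tri>)
  open import Relation.Nullary using (¬_; yes; no)
  open import Relation.Binary.PropositionalEquality using (_≡_; _≢_; refl; sym; trans; cong; subst; subst₂)
  open import Data.Nat.Solver using (module +-*-Solver)
  open +-*-Solver using (solve; _:+_; _:*_; _:=_; con)
  open Parity using (parity; parity-2+; 2∣⇒even; even⇒2∣)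
  open Divisors using (Square)

  Exact : ℕ → ℕ → ℕ → Set
  Exact p e N = p ^ e ∣ N × ¬ (p ^ suc e ∣ N)

  EvenValuations : ℕ → Set
  EvenValuations N = ∀ p e → Prime p → p ^ e ∣ N → ¬ (p ^ suc e ∣ N) → 2 ∣ e

  prime>1 : ∀ {p} → Prime p → 1 < p
  prime>1 {p} pp = nonTrivial⇒n>1 p {{prime⇒nonTrivial pp}}

  ^-monoʳ-∣ : ∀ p {a b} → a ≤ b → p ^ a ∣ p ^ b
  ^-monoʳ-∣ p {a} {b} le = divides (p ^ (b ∸ a)) (trans (cong (p ^_) (sym (m∸n+n≡m le))) (^-distribˡ-+-* p (b ∸ a) a))

  exact-unique : ∀ {p e f N} → Exact p e N → Exact p f N → e ≡ f
  exact-unique {p} {e} {f} (a , na) (b , nb) with <-cmp e f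
  ... | tri≈ _ q _ = q
  ... | tri< q _ _ = ⊥-elim (na (∣-trans (^-monoʳ-∣ p q) b))
  ... | tri> _ _ q = ⊥-elim (nb (∣-trans (^-monoʳ-∣ p q) a))

  exact-exists : ∀ {p} → Prime p → ∀ N → .{{_ : NonZero N}} → ∃ λ e → Exact p e N
  exact-exists {p} pp N = go N N ≤-refl
    where
      go : ∀ k N → N ≤ k → .{{_ : NonZero N}} → ∃ λ e → Exact p e N
      go k N le with p ∣? N
      go k N le | no np = 0 , divides N (sym (*-identityʳ N)) , λ d → np (subst (_∣ N) (*-identityʳ p) d)
      go zero N z≤n | yes _ = ⊥-elim (≢-nonZero⁻¹ N refl)
      go (suc k) N le | yes (divides q eq) = suc f , p^f+1∣N , p^f+2∤N
        where
          instance q-nonZero : NonZero q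
          q-nonZero = ≢-nonZero (λ { refl → ≢-nonZero⁻¹ N eq })
          q<N : q < N
          q<N = subst (q <_) (sym eq) (m<m*n q p (prime>1 pp))
          ih : ∃ λ f → Exact p f q
          ih = go k q (≤-pred (≤-trans q<N le))
          f = proj₁ ih
          p^f+1∣N : p ^ suc f ∣ N
          p^f+1∣N = subst (p ^ suc f ∣_) (trans (*-comm p q) (sym eq)) (*-pres-∣ (∣-refl {p}) (proj₁ (proj₂ ih)))
          p^f+2∤N : ¬ (p ^ suc (suc f) ∣ N)
          p^f+2∤N d = proj₂ (proj₂ ih) (*-cancelˡ-∣ p {{prime⇒nonZero pp}} (subst (p * p ^ suc f ∣_) (trans eq (*-comm q p)) d))

  -- Exponents of a prime add under multiplication (Euclid's lemma).
  exact-* : ∀ {p a b x y} → Prime p → Exact p a x → Exact p b y → Exact p (a + b) (x * y)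
  exact-* {p} {a} {b} {x} {y} pp (divides x' ex , nx) (divides y' ey , ny) = divides (x' * y') eq , p∤
    where
      instance p-nonZero : NonZero p
      p-nonZero = prime⇒nonZero pp
      eq : x * y ≡ (x' * y') * p ^ (a + b)
      eq rewrite ex | ey | ^-distribˡ-+-* p a b =
        solve 4 (λ X Y A B → (X :* A) :* (Y :* B) := (X :* Y) :* (A :* B)) refl x' y' (p ^ a) (p ^ b)
      cofactor : ∀ {z z' c} → z ≡ z' * p ^ c → ¬ (p ^ suc c ∣ z) → ¬ (p ∣ z')
      cofactor {z} {z'} {c} ez nz (divides r e) =
        nz (divides r (trans ez (trans (cong (_* p ^ c) e) (*-assoc r p (p ^ c)))))
      p∤ : ¬ (p ^ suc (a + b) ∣ x * y)
      p∤ d with euclidsLemma x' y' pp (*-cancelˡ-∣ (p ^ (a + b)) {{m^n≢0 p (a + b)}}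
                 (subst₂ _∣_ (*-comm p (p ^ (a + b))) (trans eq (*-comm (x' * y') _)) d))
      ... | inj₁ q = cofactor {c = a} ex nx q
      ... | inj₂ q = cofactor {c = b} ey ny q

  -- In m * m every prime occurs with exponent f + f.
  square⇒even-valuations : ∀ N → .{{_ : NonZero N}} → Square N → EvenValuations N
  square⇒even-valuations N (m , refl) p e pp d nd =
    subst (2 ∣_) (exact-unique (exact-* {a = f} {b = f} pp ex ex) (d , nd)) (divides f (solve 1 (λ F → F :+ F := F :* con 2) refl f))
    where
      instance m-nonZero : NonZero m
      m-nonZero = ≢-nonZero (λ { refl → ≢-nonZero⁻¹ (m * m) refl })
      f : ℕ
      f = proj₁ (exact-exists pp m)
      ex : Exact p f m
      ex = proj₂ (exact-exists pp m)

  even-valuation⇒p²∣ : ∀ {p N} .{{_ : NonZero N}} → Prime p → EvenValuations N → p ∣ N → p ^ 2 ∣ N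
  even-valuation⇒p²∣ {p} {N} pp ev p∣N = ∣-trans (^-monoʳ-∣ p 2≤e) (proj₁ exact)
    where
      e : ℕ
      e = proj₁ (exact-exists pp N)
      exact : Exact p e N
      exact = proj₂ (exact-exists pp N)
      e≢0 : e ≢ 0
      e≢0 e≡0 = proj₂ exact (subst (λ z → p ^ suc z ∣ N) (sym e≡0) (subst (_∣ N) (sym (*-identityʳ p)) p∣N))
      2≤e : 2 ≤ e
      2≤e with e | e≢0 | ev p e pp (proj₁ exact) (proj₂ exact)
      ... | zero | e≢0 | _ = ⊥-elim (e≢0 refl)
      ... | suc zero | _ | d with () ← 2∣⇒even d
      ... | suc (suc _) | _ | _ = s≤s (s≤s z≤n)

  even-valuations-÷p² : ∀ {p M} → Prime p → EvenValuations (M * p ^ 2) → EvenValuations M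
  even-valuations-÷p² {p} {M} pp ev q f qq q^f∣M q^f+1∤M with q ≟ p
  ... | yes refl = even⇒2∣ f (trans (sym (parity-2+ f)) (trans (cong parity (+-comm 2 f))
                     (2∣⇒even (ev q (f + 2) qq (proj₁ ex) (proj₂ ex)))))
    where
      instance q-nonZero : NonZero q
      q-nonZero = prime⇒nonZero qq
      ex : Exact q (f + 2) (M * q ^ 2)
      ex = exact-* {a = f} {b = 2} qq (q^f∣M , q^f+1∤M) (∣-refl , >⇒∤ {{m^n≢0 q 2}} (^-monoʳ-< q (prime>1 qq) {2} {3} ≤-refl))
  ... | no q≢p = subst (2 ∣_) (+-identityʳ f) (ev q (f + 0) qq (proj₁ ex) (proj₂ ex))
    where
      q∤p : ¬ (q ∣ p)
      q∤p q∣p with prime⇒irreducible pp q∣p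
      ... | inj₁ refl = <-irrefl refl (prime>1 qq)
      ... | inj₂ q≡p = q≢p q≡p
      q∤p² : ¬ (q ^ 1 ∣ p ^ 2)
      q∤p² d with euclidsLemma p (p * 1) qq (subst (_∣ p ^ 2) (*-identityʳ q) d)
      ... | inj₁ q∣p = q∤p q∣p
      ... | inj₂ q∣p = q∤p (subst (q ∣_) (*-identityʳ p) q∣p)
      ex : Exact q (f + 0) (M * p ^ 2)
      ex = exact-* {a = f} {b = 0} qq (q^f∣M , q^f+1∤M) (divides (p ^ 2) (sym (*-identityʳ _)) , q∤p²)

  -- Conversely, all exponents even makes N a square: induction on N, dividing
  -- out the square of a prime factor.
  even-valuations⇒square : ∀ N → .{{_ : NonZero N}} → EvenValuations N → Square N
  even-valuations⇒square N = go N N ≤-refl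
    where
      go : ∀ k N → N ≤ k → .{{_ : NonZero N}} → EvenValuations N → Square N
      go zero N z≤n ev = ⊥-elim (≢-nonZero⁻¹ N refl)
      go (suc k) N le ev with N ≟ 1 | factorise N
      ... | yes refl | _ = 1 , refl
      ... | no N≢1 | record { factors = [] ; isFactorisation = e } = ⊥-elim (N≢1 e)
      ... | no _ | record { factors = p ∷ ps ; isFactorisation = e ; factorsPrime = pp ∷ _ }
          with divides M N≡Mp² ← even-valuation⇒p²∣ pp ev (divides (product ps) (trans e (*-comm p (product ps))))
          = m * p , trans (solve 2 (λ X P → (X :* P) :* (X :* P) := (X :* X) :* (P :* (P :* con 1))) refl m p)
                          (trans (cong (_* p ^ 2) m²≡M) (sym N≡Mp²))
        where
          instance p-nonZero : NonZero p
          p-nonZero = prime⇒nonZero pp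
          instance M-nonZero : NonZero M
          M-nonZero = ≢-nonZero (λ M≡0 → ≢-nonZero⁻¹ N (trans N≡Mp² (cong (_* p ^ 2) M≡0)))
          M<N : M < N
          M<N = subst (M <_) (sym N≡Mp²)
                  (m<m*n M (p ^ 2) (≤-trans (prime>1 pp) (subst (_≤ p ^ 2) (*-identityʳ p) (^-monoʳ-≤ p {1} {2} (s≤s z≤n)))))
          root : Square M
          root = go k M (≤-pred (≤-trans M<N le)) (even-valuations-÷p² pp (subst EvenValuations N≡Mp² ev))
          m : ℕ
          m = proj₁ root
          m²≡M : m * m ≡ M
          m²≡M = proj₂ root

-- The parity of Σ_{d ∣ n} (1 + d) for n = 2^α n' with n' odd.
module DivisorSum where
  open import Data.Nat using (ℕ; zero; suc; _+_; _*_; _^_; NonZero)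
  open import Data.Nat.Properties using (*-identityˡ; *-assoc; *-cancelˡ-≡; ^-distribˡ-+-*)
  open import Data.Nat.Divisibility using (_∣_; divides; ∣n⇒∣m*n)
  open import Data.Bool using (Bool; true; false; not; _xor_; _∧_)
  open import Data.Bool.Properties using (_≟_; ∧-zeroʳ)
  open import Data.List using (List; []; _∷_; length; filter)
  open import Data.List.Membership.Propositional.Properties using (∈-filter⁺; ∈-filter⁻)
  open import Data.List.Relation.Unary.Unique.Propositional.Properties using (filter⁺)
  open import Data.Product using (∃; _×_; _,_; proj₁; proj₂)
  open import Data.Sum using (inj₁; inj₂)
  open import Relation.Nullary using (Dec; yes; no; does)
  open import Relation.Binary.PropositionalEquality using (_≡_; refl; sym; trans; cong; cong₂; subst; module ≡-Reasoning)
  open import Data.Nat.Solver using (module +-*-Solver)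
  open +-*-Solver using (solve; _:+_; _:*_; _:=_; con)
  open Parity using (parity; parity-+; parity-*; parity-double; parity-2+; halve)
  open DistinctLists using (same-length)
  open Divisors using (Square; square?; divisors; divisors-unique; ∈-divisors⁺; ∈-divisors⁻; divisor-count-parity)

  -- Σ_{e ∈ L} (1 + e); for L the divisors of n this counts the subgroups of D_n.
  sum1+ : List ℕ → ℕ
  sum1+ [] = 0
  sum1+ (e ∷ es) = suc e + sum1+ es

  odd? : ∀ e → Dec (parity e ≡ true)
  odd? e = parity e ≟ true

  sum1+-parity : ∀ L → parity (sum1+ L) ≡ parity (length L) xor parity (length (filter odd? L))
  sum1+-parity [] = refl
  sum1+-parity (e ∷ es) rewrite parity-+ e (sum1+ es) | sum1+-parity es with parity e
  ... | true = shuffle (parity (length es)) (parity (length (filter odd? es)))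
    where
      shuffle : ∀ a b → not (true xor (a xor b)) ≡ not a xor not b
      shuffle true true = refl
      shuffle true false = refl
      shuffle false true = refl
      shuffle false false = refl
  ... | false = shuffle (parity (length es)) (parity (length (filter odd? es)))
    where
      shuffle : ∀ a b → not (a xor b) ≡ not a xor b
      shuffle true true = refl
      shuffle true false = refl
      shuffle false true = refl
      shuffle false false = refl

  parity-odd-* : ∀ k e → parity (suc (k + k) * e) ≡ parity e
  parity-odd-* k e rewrite parity-* (suc (k + k)) e | parity-double k = refl

  even-square-root : ∀ y m → 2 * y ≡ m * m → ∃ λ k → m ≡ k + k × y ≡ 2 * (k * k)
  even-square-root y m e with halve m
  ... | inj₂ (k , refl)
    with () ← trans (sym (trans (parity-odd-* k (suc (k + k))) (cong not (parity-double k))))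
                    (trans (cong parity (sym e)) (parity-* 2 y))
  ... | inj₁ (k , refl) = k , refl , *-cancelˡ-≡ y (2 * (k * k)) 2
          (trans e (solve 1 (λ K → (K :+ K) :* (K :+ K) := con 2 :* (con 2 :* (K :* K))) refl k))

  -- For odd n', 2 ^ α * n' is a square iff α is even and n' is a square.
  -- (⇒: a square 2 n' would be even with an even root, hence divisible by 4;
  -- a square 4 m has root 2 k with m = k * k, so induct on α.)
  square-2^α*⇒ : ∀ α n' → parity n' ≡ true → Square (2 ^ α * n') → parity α ≡ false × Square n'
  square-2^α*⇒ zero n' odd (m , e) = refl , m , trans e (*-identityˡ n')
  square-2^α*⇒ (suc zero) n' odd (m , e)
    with k , _ , refl ← even-square-root n' m (trans (solve 1 (λ N → con 2 :* N := (con 2 :* con 1) :* N) refl n') (sym e))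
    with () ← trans (sym odd) (parity-* 2 (k * k))
  square-2^α*⇒ (suc (suc α)) n' odd (m , e)
    with k , _ , e₂ ← even-square-root (2 * (2 ^ α * n')) m
           (trans (solve 2 (λ A N → con 2 :* (con 2 :* (A :* N)) := (con 2 :* (con 2 :* A)) :* N) refl (2 ^ α) n') (sym e))
    with square-2^α*⇒ α n' odd (k , sym (*-cancelˡ-≡ (2 ^ α * n') (k * k) 2 e₂))
  ... | α-even , sq = trans (parity-2+ α) α-even , sq

  square-2^α*⇐ : ∀ α n' → parity α ≡ false → Square n' → Square (2 ^ α * n')
  square-2^α*⇐ α n' α-even (m , refl) with halve α
  ... | inj₂ (k , refl) with () ← trans (sym α-even) (cong not (parity-double k))
  ... | inj₁ (k , refl) = 2 ^ k * m ,
        trans (solve 2 (λ A M → (A :* M) :* (A :* M) := (A :* A) :* (M :* M)) refl (2 ^ k) m)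
              (cong (_* (m * m)) (sym (^-distribˡ-+-* 2 k k)))

  -- An odd divisor of 2 ^ α * x divides x: if e q = 2 y with e odd, q is even.
  odd-∣-2^α* : ∀ {e} α x → parity e ≡ true → e ∣ 2 ^ α * x → e ∣ x
  odd-∣-2^α* {e} zero x odd d = subst (e ∣_) (*-identityˡ x) d
  odd-∣-2^α* {e} (suc α) x odd (divides q eq) with halve q
  ... | inj₂ (k , refl)
    with () ← trans (sym (trans (parity-odd-* k e) odd))
                    (trans (cong parity (trans (sym eq) (*-assoc 2 (2 ^ α) x))) (parity-* 2 (2 ^ α * x)))
  ... | inj₁ (k , refl) = odd-∣-2^α* α x odd (divides k (*-cancelˡ-≡ (2 ^ α * x) (k * e) 2
          (trans (trans (sym (*-assoc 2 (2 ^ α) x)) eq) (solve 2 (λ K E → (K :+ K) :* E := con 2 :* (K :* E)) refl k e))))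

  odd-divisor : ∀ {e n'} → parity n' ≡ true → e ∣ n' → parity e ≡ true
  odd-divisor {e} odd (divides q refl) with parity e in pe
  ... | true = refl
  ... | false with () ← trans (sym odd) (trans (parity-* q e) (trans (cong (parity q ∧_) pe) (∧-zeroʳ (parity q))))

  odd-divisors : ∀ α n' → parity n' ≡ true → .{{_ : NonZero n'}} → .{{_ : NonZero (2 ^ α * n')}} →
    length (filter odd? (divisors (2 ^ α * n'))) ≡ length (divisors n')
  odd-divisors α n' odd = same-length (filter⁺ odd? {divisors (2 ^ α * n')} (divisors-unique (2 ^ α * n'))) (divisors-unique n')
    (λ p → let (d , oe) = ∈-filter⁻ odd? {xs = divisors (2 ^ α * n')} p in
        ∈-divisors⁺ {n'} (odd-∣-2^α* α n' oe (∈-divisors⁻ {2 ^ α * n'} d)))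
    (λ p → ∈-filter⁺ odd? (∈-divisors⁺ {2 ^ α * n'} (∣n⇒∣m*n (2 ^ α) (∈-divisors⁻ {n'} p)))
                          (odd-divisor odd (∈-divisors⁻ {n'} p)))

  -- Σ_{e ∣ 2^α n'} (1 + e) is odd iff α is odd and n' is a square:
  -- modulo 2 it is τ(2^α n') + τ(n'), and τ(N) is odd iff N is a square.
  sum1+-divisors-parity : ∀ α n' → parity n' ≡ true → .{{_ : NonZero n'}} → .{{_ : NonZero (2 ^ α * n')}} →
    parity (sum1+ (divisors (2 ^ α * n'))) ≡ parity α ∧ does (square? n')
  sum1+-divisors-parity α n' odd = begin
      parity (sum1+ (divisors n))
        ≡⟨ sum1+-parity (divisors n) ⟩
      parity (length (divisors n)) xor parity (length (filter odd? (divisors n)))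
        ≡⟨ cong₂ _xor_ (divisor-count-parity n) (cong parity (odd-divisors α n' odd)) ⟩
      does (square? n) xor parity (length (divisors n'))
        ≡⟨ cong (does (square? n) xor_) (divisor-count-parity n') ⟩
      does (square? n) xor does (square? n')
        ≡⟨ squares ⟩
      parity α ∧ does (square? n') ∎
    where
      open ≡-Reasoning
      n : ℕ
      n = 2 ^ α * n'
      squares : does (square? n) xor does (square? n') ≡ parity α ∧ does (square? n')
      squares with square? n | square? n' | parity α in pα
      ... | yes s | yes _  | true with () ← trans (sym pα) (proj₁ (square-2^α*⇒ α n' odd s))
      ... | yes s | yes _  | false = refl
      ... | yes s | no ns' | _ with () ← ns' (proj₂ (square-2^α*⇒ α n' odd s))
      ... | no ns | yes _  | true = refl
      ... | no ns | yes s' | false with () ← ns (square-2^α*⇐ α n' pα s')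
      ... | no ns | no _   | true = refl
      ... | no ns | no _   | false = refl

-- The dihedral group D_n of Defs: normal forms a^x, a^x b with x ∈ ℕ, and the
-- group laws.
module Dihedral (n : ℕ) .{{_ : NonZero n}} where
  open import Defs
  open import Data.Nat using (_+_; _∸_; _%_; >-nonZero⁻¹)
  open import Data.Nat.Properties using (+-assoc; +-comm; +-identityʳ; m+[n∸m]≡n)
  open import Data.Nat.DivMod using (_mod_; %-distribˡ-+; m%n%n≡m%n; m<n⇒m%n≡m; n%n≡0; m%n<n; m%n≤n)
  open import Data.Fin using (Fin; toℕ)
  open import Data.Fin.Properties using (toℕ-injective; toℕ-fromℕ<; toℕ<n)
  open import Data.Sum using (_⊎_; inj₁; inj₂)
  open import Data.Product using (_,_)
  open import Level using (0ℓ)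
  open import Algebra.Bundles using (Group)
  import Algebra.Properties.Group
  open import Relation.Binary.PropositionalEquality using (_≡_; refl; sym; trans; cong; cong₂; subst; isEquivalence; module ≡-Reasoning)
  open import Data.Nat.Solver using (module +-*-Solver)
  open +-*-Solver using (solve; _:+_; _:=_)

  ⌊_⌋ : ℕ → Fin n
  ⌊ x ⌋ = x mod n

  infix 4 _≈_
  _≈_ : ℕ → ℕ → Set
  x ≈ y = x % n ≡ y % n

  neg : ℕ → ℕ
  neg x = n ∸ x % n

  toℕ-⌊⌋ : ∀ x → toℕ ⌊ x ⌋ ≡ x % n
  toℕ-⌊⌋ x = toℕ-fromℕ< (m%n<n x n)

  ⌊⌋-≈ : ∀ {x y} → x ≈ y → ⌊ x ⌋ ≡ ⌊ y ⌋
  ⌊⌋-≈ {x} {y} e = toℕ-injective (trans (toℕ-⌊⌋ x) (trans e (sym (toℕ-⌊⌋ y))))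

  ≈-⌊⌋ : ∀ {x y} → ⌊ x ⌋ ≡ ⌊ y ⌋ → x ≈ y
  ≈-⌊⌋ {x} {y} e = trans (sym (toℕ-⌊⌋ x)) (trans (cong toℕ e) (toℕ-⌊⌋ y))

  ⌊toℕ⌋ : ∀ (i : Fin n) → ⌊ toℕ i ⌋ ≡ i
  ⌊toℕ⌋ i = toℕ-injective (trans (toℕ-⌊⌋ (toℕ i)) (m<n⇒m%n≡m (toℕ<n i)))

  ≡⇒≈ : ∀ {x y} → x ≡ y → x ≈ y
  ≡⇒≈ refl = refl

  %≈ : ∀ x → x % n ≈ x
  %≈ x = m%n%n≡m%n x n

  toℕ⌊⌋≈ : ∀ x → toℕ ⌊ x ⌋ ≈ x
  toℕ⌊⌋≈ x = trans (cong (_% n) (toℕ-⌊⌋ x)) (%≈ x)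

  +≈ : ∀ {a a' b b'} → a ≈ a' → b ≈ b' → a + b ≈ a' + b'
  +≈ {a} {a'} {b} {b'} p q =
    trans (%-distribˡ-+ a b n) (trans (cong₂ (λ u v → (u + v) % n) p q) (sym (%-distribˡ-+ a' b' n)))

  +≈ʳ : ∀ a {b b'} → b ≈ b' → a + b ≈ a + b'
  +≈ʳ a = +≈ {a} refl

  n≈0 : n ≈ 0
  n≈0 = trans (n%n≡0 n) (sym (m<n⇒m%n≡m (>-nonZero⁻¹ n)))

  neg-inverseʳ : ∀ a → a + neg a ≈ 0
  neg-inverseʳ a = trans (+≈ {a} {a % n} (sym (%≈ a)) refl) (trans (≡⇒≈ (m+[n∸m]≡n (m%n≤n a n))) n≈0)

  neg-inverseˡ : ∀ a → neg a + a ≈ 0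
  neg-inverseˡ a = trans (≡⇒≈ (+-comm (neg a) a)) (neg-inverseʳ a)

  neg-cancelʳ : ∀ a b → a + neg b + b ≈ a
  neg-cancelʳ a b = trans (≡⇒≈ (+-assoc a (neg b) b)) (trans (+≈ʳ a (neg-inverseˡ b)) (≡⇒≈ (+-identityʳ a)))

  neg-cancelʳ′ : ∀ a b → a + b + neg b ≈ a
  neg-cancelʳ′ a b = trans (≡⇒≈ (+-assoc a b (neg b))) (trans (+≈ʳ a (neg-inverseʳ b)) (≡⇒≈ (+-identityʳ a)))

  +-cancelʳ-≈ : ∀ {a b} c → a + c ≈ b + c → a ≈ b
  +-cancelʳ-≈ {a} {b} c e = trans (sym (neg-cancelʳ′ a c)) (trans (+≈ e refl) (neg-cancelʳ′ b c))

  neg-involutive : ∀ a → neg (neg a) ≈ a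
  neg-involutive a = +-cancelʳ-≈ (neg a) (trans (neg-inverseˡ (neg a)) (sym (neg-inverseʳ a)))

  neg-+ : ∀ a b → neg (a + b) ≈ neg a + neg b
  neg-+ a b = +-cancelʳ-≈ (a + b) (trans (neg-inverseˡ (a + b)) (sym (trans (≡⇒≈ shuffle) (+≈ (neg-inverseʳ a) (neg-inverseʳ b)))))
    where
      shuffle : (neg a + neg b) + (a + b) ≡ (a + neg a) + (b + neg b)
      shuffle = solve 4 (λ A B X Y → (X :+ Y) :+ (A :+ B) := (A :+ X) :+ (B :+ Y)) refl a b (neg a) (neg b)

  neg-+neg : ∀ a b → neg (a + neg b) ≈ neg a + b
  neg-+neg a b = trans (neg-+ a (neg b)) (+≈ʳ (neg a) (neg-involutive b))

  -- the two regroupings needed for associativity of D_n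
  sub-sub : ∀ a b c → a + neg b + neg c ≈ a + neg (b + c)
  sub-sub a b c = trans (≡⇒≈ (+-assoc a (neg b) (neg c))) (+≈ʳ a (sym (neg-+ b c)))

  sub-add : ∀ a b c → a + neg b + c ≈ a + neg (b + neg c)
  sub-add a b c = trans (≡⇒≈ (+-assoc a (neg b) c)) (+≈ʳ a (sym (neg-+neg b c)))

  neg-0 : neg 0 ≈ 0
  neg-0 = +-cancelʳ-≈ {neg 0} {0} 0 (neg-inverseˡ 0)

  infixl 7 _·_
  _·_ : El n → El n → El n
  x · y = mul n x y

  e : El n
  e = one n

  infix 8 _⁻¹
  _⁻¹ : El n → El n
  x ⁻¹ = inv n x

  rot·rot : ∀ x y → rot ⌊ x ⌋ · rot ⌊ y ⌋ ≡ rot ⌊ x + y ⌋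
  rot·rot x y = cong rot (⌊⌋-≈ (+≈ (toℕ⌊⌋≈ x) (toℕ⌊⌋≈ y)))

  rot·ref : ∀ x y → rot ⌊ x ⌋ · ref ⌊ y ⌋ ≡ ref ⌊ x + y ⌋
  rot·ref x y = cong ref (⌊⌋-≈ (+≈ (toℕ⌊⌋≈ x) (toℕ⌊⌋≈ y)))

  ref·rot : ∀ x y → ref ⌊ x ⌋ · rot ⌊ y ⌋ ≡ ref ⌊ x + neg y ⌋
  ref·rot x y = cong ref (⌊⌋-≈ (+≈ (toℕ⌊⌋≈ x) (≡⇒≈ (cong (n ∸_) (toℕ-⌊⌋ y)))))

  ref·ref : ∀ x y → ref ⌊ x ⌋ · ref ⌊ y ⌋ ≡ rot ⌊ x + neg y ⌋
  ref·ref x y = cong rot (⌊⌋-≈ (+≈ (toℕ⌊⌋≈ x) (≡⇒≈ (cong (n ∸_) (toℕ-⌊⌋ y)))))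

  rot⁻¹ : ∀ x → (rot ⌊ x ⌋) ⁻¹ ≡ rot ⌊ neg x ⌋
  rot⁻¹ x = cong rot (⌊⌋-≈ (+≈ (toℕ⌊⌋≈ 0) (≡⇒≈ (cong (n ∸_) (toℕ-⌊⌋ x)))))

  rot≈ : ∀ {a b} → a ≈ b → rot ⌊ a ⌋ ≡ rot ⌊ b ⌋
  rot≈ eq = cong rot (⌊⌋-≈ eq)

  ref≈ : ∀ {a b} → a ≈ b → ref ⌊ a ⌋ ≡ ref ⌊ b ⌋
  ref≈ eq = cong ref (⌊⌋-≈ eq)

  data View : El n → Set where
    rotʳ : ∀ x → View (rot ⌊ x ⌋)
    refʳ : ∀ x → View (ref ⌊ x ⌋)

  view : ∀ g → View g
  view (rot i) = subst View (cong rot (⌊toℕ⌋ i)) (rotʳ (toℕ i))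
  view (ref i) = subst View (cong ref (⌊toℕ⌋ i)) (refʳ (toℕ i))

  private
    meet : ∀ {A : Set} {l l' m r r' : A} → l ≡ l' → l' ≡ m → r ≡ r' → r' ≡ m → l ≡ r
    meet p q p' q' = trans p (trans q (sym (trans p' q')))

  assoc : ∀ x y z → x · y · z ≡ x · (y · z)
  assoc x y z with view x | view y | view z
  ... | rotʳ a | rotʳ b | rotʳ c = meet (cong (_· rot ⌊ c ⌋) (rot·rot a b)) (rot·rot (a + b) c)
    (cong (rot ⌊ a ⌋ ·_) (rot·rot b c)) (trans (rot·rot a (b + c)) (rot≈ (≡⇒≈ (sym (+-assoc a b c)))))
  ... | rotʳ a | rotʳ b | refʳ c = meet (cong (_· ref ⌊ c ⌋) (rot·rot a b)) (rot·ref (a + b) c)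
    (cong (rot ⌊ a ⌋ ·_) (rot·ref b c)) (trans (rot·ref a (b + c)) (ref≈ (≡⇒≈ (sym (+-assoc a b c)))))
  ... | rotʳ a | refʳ b | rotʳ c = meet (cong (_· rot ⌊ c ⌋) (rot·ref a b)) (ref·rot (a + b) c)
    (cong (rot ⌊ a ⌋ ·_) (ref·rot b c)) (trans (rot·ref a (b + neg c)) (ref≈ (≡⇒≈ (sym (+-assoc a b (neg c))))))
  ... | rotʳ a | refʳ b | refʳ c = meet (cong (_· ref ⌊ c ⌋) (rot·ref a b)) (ref·ref (a + b) c)
    (cong (rot ⌊ a ⌋ ·_) (ref·ref b c)) (trans (rot·rot a (b + neg c)) (rot≈ (≡⇒≈ (sym (+-assoc a b (neg c))))))
  ... | refʳ a | rotʳ b | rotʳ c = meet (cong (_· rot ⌊ c ⌋) (ref·rot a b)) (ref·rot (a + neg b) c)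
    (cong (ref ⌊ a ⌋ ·_) (rot·rot b c)) (trans (ref·rot a (b + c)) (ref≈ (sym (sub-sub a b c))))
  ... | refʳ a | rotʳ b | refʳ c = meet (cong (_· ref ⌊ c ⌋) (ref·rot a b)) (ref·ref (a + neg b) c)
    (cong (ref ⌊ a ⌋ ·_) (rot·ref b c)) (trans (ref·ref a (b + c)) (rot≈ (sym (sub-sub a b c))))
  ... | refʳ a | refʳ b | rotʳ c = meet (cong (_· rot ⌊ c ⌋) (ref·ref a b)) (rot·rot (a + neg b) c)
    (cong (ref ⌊ a ⌋ ·_) (ref·rot b c)) (trans (ref·ref a (b + neg c)) (rot≈ (sym (sub-add a b c))))
  ... | refʳ a | refʳ b | refʳ c = meet (cong (_· ref ⌊ c ⌋) (ref·ref a b)) (rot·ref (a + neg b) c)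
    (cong (ref ⌊ a ⌋ ·_) (ref·ref b c)) (trans (ref·rot a (b + neg c)) (ref≈ (sym (sub-add a b c))))

  identityˡ : ∀ x → e · x ≡ x
  identityˡ x with view x
  ... | rotʳ a = rot·rot 0 a
  ... | refʳ a = rot·ref 0 a

  identityʳ : ∀ x → x · e ≡ x
  identityʳ x with view x
  ... | rotʳ a = trans (rot·rot a 0) (rot≈ (≡⇒≈ (+-identityʳ a)))
  ... | refʳ a = trans (ref·rot a 0) (ref≈ (trans (+≈ʳ a neg-0) (≡⇒≈ (+-identityʳ a))))

  inverseˡ : ∀ x → x ⁻¹ · x ≡ e
  inverseˡ x with view x
  ... | rotʳ a = trans (cong (_· rot ⌊ a ⌋) (rot⁻¹ a)) (trans (rot·rot (neg a) a) (rot≈ (neg-inverseˡ a)))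
  ... | refʳ a = trans (ref·ref a a) (rot≈ (neg-inverseʳ a))

  inverseʳ : ∀ x → x · x ⁻¹ ≡ e
  inverseʳ x with view x
  ... | rotʳ a = trans (cong (rot ⌊ a ⌋ ·_) (rot⁻¹ a)) (trans (rot·rot a (neg a)) (rot≈ (neg-inverseʳ a)))
  ... | refʳ a = trans (ref·ref a a) (rot≈ (neg-inverseʳ a))

  -- D_n as a group of the standard library, for its derived laws.
  dihedral : Group 0ℓ 0ℓ
  dihedral = record
    { isGroup = record
      { isMonoid = record
        { isSemigroup = record { isMagma = record { isEquivalence = isEquivalence ; ∙-cong = cong₂ _·_ } ; assoc = assoc }
        ; identity = identityˡ , identityʳ }
      ; inverse = inverseˡ , inverseʳ
      ; ⁻¹-cong = cong _⁻¹ } }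

  open Algebra.Properties.Group dihedral public using (⁻¹-involutive; ⁻¹-anti-homo-∙)

  conjugate-rot : ∀ i k → k ⁻¹ · rot i · k ≡ rot i ⊎ k ⁻¹ · rot i · k ≡ (rot i) ⁻¹
  conjugate-rot i k with view (rot i) | view k
  ... | rotʳ a | rotʳ b = inj₁ (begin
    rot ⌊ b ⌋ ⁻¹ · rot ⌊ a ⌋ · rot ⌊ b ⌋ ≡⟨ cong (λ w → w · rot ⌊ a ⌋ · rot ⌊ b ⌋) (rot⁻¹ b) ⟩
    rot ⌊ neg b ⌋ · rot ⌊ a ⌋ · rot ⌊ b ⌋ ≡⟨ cong (_· rot ⌊ b ⌋) (rot·rot (neg b) a) ⟩
    rot ⌊ neg b + a ⌋ · rot ⌊ b ⌋        ≡⟨ rot·rot (neg b + a) b ⟩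
    rot ⌊ neg b + a + b ⌋                ≡⟨ rot≈ (trans (≡⇒≈ (cong (_+ b) (+-comm (neg b) a))) (neg-cancelʳ a b)) ⟩
    rot ⌊ a ⌋                            ∎)
    where open ≡-Reasoning
  ... | rotʳ a | refʳ b = inj₂ (begin
    ref ⌊ b ⌋ · rot ⌊ a ⌋ · ref ⌊ b ⌋ ≡⟨ cong (_· ref ⌊ b ⌋) (ref·rot b a) ⟩
    ref ⌊ b + neg a ⌋ · ref ⌊ b ⌋     ≡⟨ ref·ref (b + neg a) b ⟩
    rot ⌊ b + neg a + neg b ⌋         ≡⟨ rot≈ (trans (≡⇒≈ (cong (_+ neg b) (+-comm b (neg a)))) (neg-cancelʳ′ (neg a) b)) ⟩
    rot ⌊ neg a ⌋                     ≡⟨ sym (rot⁻¹ a) ⟩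
    rot ⌊ a ⌋ ⁻¹                      ∎)
    where open ≡-Reasoning

-- Subsets and subgroups of D_n: the subgroups ⟨a^d⟩ and ⟨a^d, a^j b⟩ for
-- d ∣ n, j < d, and the fact that there are no others.
module Subgroups (n : ℕ) .{{_ : NonZero n}} where
  open import Defs
  open Dihedral n
  open import Data.Nat using (zero; suc; _+_; _*_; _%_; _/_; _≤_; _<_; z≤n; s≤s; _≟_; >-nonZero; >-nonZero⁻¹)
  open import Data.Nat.Properties using (≤-trans; ≤-antisym; ≤-pred; ≤∧≢⇒<; n≤1+n; <-irrefl; +-identityʳ; +-suc)
  open import Data.Nat.DivMod using (%-distribˡ-+; m%n%n≡m%n; m<n⇒m%n≡m; m%n<n; m∣n⇒o%n%m≡o%m; m≡m%n+[m/n]*n)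
  open import Data.Nat.Divisibility using (_∣_; m%n≡0⇒n∣m)
  open import Data.Fin using (Fin; toℕ)
  open import Data.Fin.Properties using (any?)
  import Data.Fin.Subset
  open import Data.Fin.Subset.Properties using (_∈?_; ⊆-antisym; ∉⊥; ∈⊤; x∈⁅x⁆; x∈⁅y⁆⇒x≡y)
  open import Data.Vec using (tabulate)
  open import Data.Vec.Properties using ([]=⇒lookup; lookup⇒[]=; lookup∘tabulate)
  open import Data.Bool using (true)
  open import Data.Product using (∃; _×_; _,_; proj₁; proj₂)
  open import Data.Sum using (_⊎_; inj₁; inj₂)
  open import Data.Empty using (⊥-elim) renaming (⊥ to Empty)
  open import Function.Construct.Composition using (_⇔-∘_)
  open import Function.Bundles using (_⇔_; mk⇔; Equivalence)
  open import Relation.Nullary using (¬_; Dec; yes; no; does)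
  open import Relation.Nullary.Decidable using (dec-true)
  open import Relation.Binary.PropositionalEquality using (_≡_; _≢_; refl; sym; trans; cong; cong₂; subst; module ≡-Reasoning)
  open Equivalence using (to; from)

  infix 4 _∈ˢ_
  _∈ˢ_ : El n → Sub n → Set
  x ∈ˢ S = _∈ₛ_ n x S

  _∈ˢ?_ : ∀ x S → Dec (x ∈ˢ S)
  rot i ∈ˢ? S = i ∈? proj₁ S
  ref i ∈ˢ? S = i ∈? proj₂ S

  sub-ext : ∀ (S T : Sub n) → (∀ x → x ∈ˢ S → x ∈ˢ T) → (∀ x → x ∈ˢ T → x ∈ˢ S) → S ≡ T
  sub-ext (R , F) (R' , F') f g =
    cong₂ _,_ (⊆-antisym (f (rot _)) (g (rot _))) (⊆-antisym (f (ref _)) (g (ref _)))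

  subsetOf : (P : El n → Set) → (∀ x → Dec (P x)) → Sub n
  subsetOf P P? = tabulate (λ i → does (P? (rot i))) , tabulate (λ i → does (P? (ref i)))

  private
    does-true : ∀ {A : Set} (d : Dec A) → does d ≡ true → A
    does-true (yes a) _ = a

    ∈-tabulate : ∀ {Q : Fin n → Set} (Q? : ∀ i → Dec (Q i)) i →
      (i Data.Fin.Subset.∈ tabulate (λ i → does (Q? i))) ⇔ Q i
    ∈-tabulate Q? i = mk⇔
      (λ p → does-true (Q? i) (trans (sym (lookup∘tabulate _ i)) ([]=⇒lookup p)))
      (λ q → lookup⇒[]= i _ (trans (lookup∘tabulate _ i) (dec-true (Q? i) q)))

  ∈-subsetOf : ∀ P P? x → x ∈ˢ subsetOf P P? ⇔ P x
  ∈-subsetOf P P? (rot i) = ∈-tabulate (λ i → P? (rot i)) i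
  ∈-subsetOf P P? (ref i) = ∈-tabulate (λ i → P? (ref i)) i

  ∈-trivial⁻ : ∀ x → x ∈ˢ trivialSub n → x ≡ e
  ∈-trivial⁻ (rot i) p = cong rot (x∈⁅y⁆⇒x≡y _ p)
  ∈-trivial⁻ (ref i) p = ⊥-elim (∉⊥ p)

  ∈-trivial⁺ : ∀ {x} → x ≡ e → x ∈ˢ trivialSub n
  ∈-trivial⁺ refl = x∈⁅x⁆ _

  ∈-full : ∀ x → x ∈ˢ fullSub n
  ∈-full (rot i) = ∈⊤
  ∈-full (ref i) = ∈⊤

  trivial-subgroup : IsSubgroup n (trivialSub n)
  trivial-subgroup = ∈-trivial⁺ refl ,
    (λ x y px py → ∈-trivial⁺ (trans (cong₂ _·_ (∈-trivial⁻ x px) (∈-trivial⁻ y py)) (identityˡ e))) ,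
    (λ x px → ∈-trivial⁺ (trans (cong _⁻¹ (∈-trivial⁻ x px)) (trans (sym (identityʳ (e ⁻¹))) (inverseˡ e))))

  full-subgroup : IsSubgroup n (fullSub n)
  full-subgroup = ∈-full e , (λ x y _ _ → ∈-full (x · y)) , (λ x _ → ∈-full (x ⁻¹))

  trivial≢full : trivialSub n ≢ fullSub n
  trivial≢full eq with () ← ∈-trivial⁻ (ref ⌊ 0 ⌋) (subst (ref ⌊ 0 ⌋ ∈ˢ_) (sym eq) (∈-full (ref ⌊ 0 ⌋)))

  record Description (S : Sub n) : Set₁ where
    field
      InRot InRef : ℕ → Set
      rot-∈ : ∀ x → rot ⌊ x ⌋ ∈ˢ S ⇔ InRot x
      ref-∈ : ∀ x → ref ⌊ x ⌋ ∈ˢ S ⇔ InRef x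
      rot-0 : InRot 0
      rot-rot : ∀ {a b} → InRot a → InRot b → InRot (a + b)
      rot-neg : ∀ {a} → InRot a → InRot (neg a)
      rot-ref : ∀ {a b} → InRot a → InRef b → InRef (a + b)
      ref-rot : ∀ {a b} → InRef a → InRot b → InRef (a + neg b)
      ref-ref : ∀ {a b} → InRef a → InRef b → InRot (a + neg b)

  described⇒subgroup : ∀ {S} → Description S → IsSubgroup n S
  described⇒subgroup {S} D = from (rot-∈ 0) rot-0 , closed-· , closed-⁻¹
    where
      open Description D
      closed-· : ∀ x y → x ∈ˢ S → y ∈ˢ S → x · y ∈ˢ S
      closed-· x y px py with view x | view y
      ... | rotʳ a | rotʳ b = subst (_∈ˢ S) (sym (rot·rot a b)) (from (rot-∈ _) (rot-rot (to (rot-∈ a) px) (to (rot-∈ b) py)))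
      ... | rotʳ a | refʳ b = subst (_∈ˢ S) (sym (rot·ref a b)) (from (ref-∈ _) (rot-ref (to (rot-∈ a) px) (to (ref-∈ b) py)))
      ... | refʳ a | rotʳ b = subst (_∈ˢ S) (sym (ref·rot a b)) (from (ref-∈ _) (ref-rot (to (ref-∈ a) px) (to (rot-∈ b) py)))
      ... | refʳ a | refʳ b = subst (_∈ˢ S) (sym (ref·ref a b)) (from (rot-∈ _) (ref-ref (to (ref-∈ a) px) (to (ref-∈ b) py)))
      closed-⁻¹ : ∀ x → x ∈ˢ S → x ⁻¹ ∈ˢ S
      closed-⁻¹ x px with view x
      ... | rotʳ a = subst (_∈ˢ S) (sym (rot⁻¹ a)) (from (rot-∈ _) (rot-neg (to (rot-∈ a) px)))
      ... | refʳ a = px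

  -- x mod e, made total in e (e = 0 never occurs for divisors of n).
  rem : ℕ → ℕ → ℕ
  rem x zero = x
  rem x (suc e) = x % suc e

  rem-% : ∀ x d .{{_ : NonZero d}} → rem x d ≡ x % d
  rem-% x (suc d) = refl

  InCyclic : ℕ → El n → Set
  InCyclic d (rot i) = rem (toℕ i) d ≡ 0
  InCyclic d (ref i) = Empty

  InDihedral : ℕ → ℕ → El n → Set
  InDihedral d j (rot i) = rem (toℕ i) d ≡ 0
  InDihedral d j (ref i) = rem (toℕ i) d ≡ j

  inCyclic? : ∀ d x → Dec (InCyclic d x)
  inCyclic? d (rot i) = rem (toℕ i) d ≟ 0
  inCyclic? d (ref i) = no λ ()

  inDihedral? : ∀ d j x → Dec (InDihedral d j x)
  inDihedral? d j (rot i) = rem (toℕ i) d ≟ 0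
  inDihedral? d j (ref i) = rem (toℕ i) d ≟ j

  -- ⟨a^d⟩ = { a^x | d ∣ x }
  cyclicSub : ℕ → Sub n
  cyclicSub d = subsetOf (InCyclic d) (inCyclic? d)

  -- ⟨a^d, a^j b⟩ = { a^x | d ∣ x } ∪ { a^x b | x ≡ j mod d }
  dihedralSub : ℕ → ℕ → Sub n
  dihedralSub d j = subsetOf (InDihedral d j) (inDihedral? d j)

  -- For a divisor d of n, residues mod d are well defined on ℤ/nℤ.
  module Residues (d : ℕ) .{{_ : NonZero d}} (d∣n : d ∣ n) where

    %d-≈ : ∀ {x y} → x ≈ y → x % d ≡ y % d
    %d-≈ {x} {y} eq = trans (sym (m∣n⇒o%n%m≡o%m d n x d∣n)) (trans (cong (_% d) eq) (m∣n⇒o%n%m≡o%m d n y d∣n))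

    residue⇔ : ∀ {r} x → (rem (toℕ ⌊ x ⌋) d ≡ r) ⇔ (x % d ≡ r)
    residue⇔ x = mk⇔ (trans (sym rem≡)) (trans rem≡)
      where
        rem≡ : rem (toℕ ⌊ x ⌋) d ≡ x % d
        rem≡ = trans (rem-% (toℕ ⌊ x ⌋) d) (%d-≈ (toℕ⌊⌋≈ x))

    0%d : 0 % d ≡ 0
    0%d = m<n⇒m%n≡m (>-nonZero⁻¹ d)

    neg-0-residue : ∀ {a} → a % d ≡ 0 → neg a % d ≡ 0
    neg-0-residue {a} p = begin
      neg a % d                 ≡⟨ sym (m%n%n≡m%n (neg a) d) ⟩
      (0 + neg a % d) % d       ≡⟨ cong (λ u → (u + neg a % d) % d) (sym p) ⟩
      (a % d + neg a % d) % d   ≡⟨ sym (%-distribˡ-+ a (neg a) d) ⟩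
      (a + neg a) % d           ≡⟨ trans (%d-≈ (neg-inverseʳ a)) 0%d ⟩
      0                         ∎
      where open ≡-Reasoning

    sub-residue : ∀ {a b} → a % d ≡ b % d → (a + neg b) % d ≡ 0
    sub-residue {a} {b} p = begin
      (a + neg b) % d           ≡⟨ %-distribˡ-+ a (neg b) d ⟩
      (a % d + neg b % d) % d   ≡⟨ cong (λ u → (u + neg b % d) % d) p ⟩
      (b % d + neg b % d) % d   ≡⟨ sym (%-distribˡ-+ b (neg b) d) ⟩
      (b + neg b) % d           ≡⟨ trans (%d-≈ (neg-inverseʳ b)) 0%d ⟩
      0                         ∎
      where open ≡-Reasoning

    sub-residue⁻ : ∀ {a b} → (a + neg b) % d ≡ 0 → a % d ≡ b % d
    sub-residue⁻ {a} {b} p = begin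
      a % d                             ≡⟨ %d-≈ (sym (neg-cancelʳ a b)) ⟩
      (a + neg b + b) % d               ≡⟨ %-distribˡ-+ (a + neg b) b d ⟩
      ((a + neg b) % d + b % d) % d     ≡⟨ cong (λ u → (u + b % d) % d) p ⟩
      b % d % d                         ≡⟨ m%n%n≡m%n b d ⟩
      b % d                             ∎
      where open ≡-Reasoning

    rot-∈-cyclic : ∀ x → rot ⌊ x ⌋ ∈ˢ cyclicSub d ⇔ (x % d ≡ 0)
    rot-∈-cyclic x = residue⇔ x ⇔-∘ ∈-subsetOf (InCyclic d) (inCyclic? d) (rot ⌊ x ⌋)

    ref-∉-cyclic : ∀ x → ¬ (ref ⌊ x ⌋ ∈ˢ cyclicSub d)
    ref-∉-cyclic x = to (∈-subsetOf (InCyclic d) (inCyclic? d) (ref ⌊ x ⌋))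

    rot-∈-dihedral : ∀ j x → rot ⌊ x ⌋ ∈ˢ dihedralSub d j ⇔ (x % d ≡ 0)
    rot-∈-dihedral j x = residue⇔ x ⇔-∘ ∈-subsetOf (InDihedral d j) (inDihedral? d j) (rot ⌊ x ⌋)

    ref-∈-dihedral : ∀ j x → ref ⌊ x ⌋ ∈ˢ dihedralSub d j ⇔ (x % d ≡ j)
    ref-∈-dihedral j x = residue⇔ x ⇔-∘ ∈-subsetOf (InDihedral d j) (inDihedral? d j) (ref ⌊ x ⌋)

    add-0-residue : ∀ {a b r} → r < d → a % d ≡ 0 → b % d ≡ r → (a + b) % d ≡ r
    add-0-residue {a} {b} r<d p q = trans (%-distribˡ-+ a b d) (trans (cong₂ (λ u v → (u + v) % d) p q) (m<n⇒m%n≡m r<d))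

    sub-0-residue : ∀ {a b r} → a % d ≡ r → b % d ≡ 0 → (a + neg b) % d ≡ r
    sub-0-residue {a} {b} {r} p q = begin
      (a + neg b) % d           ≡⟨ %-distribˡ-+ a (neg b) d ⟩
      (a % d + neg b % d) % d   ≡⟨ cong (λ u → (a % d + u) % d) (neg-0-residue q) ⟩
      (a % d + 0) % d           ≡⟨ cong (_% d) (+-identityʳ (a % d)) ⟩
      a % d % d                 ≡⟨ m%n%n≡m%n a d ⟩
      a % d                     ≡⟨ p ⟩
      r                         ∎
      where open ≡-Reasoning

    cyclic-subgroup : IsSubgroup n (cyclicSub d)
    cyclic-subgroup = described⇒subgroup record
      { InRot = λ x → x % d ≡ 0 ; InRef = λ _ → Empty
      ; rot-∈ = rot-∈-cyclic ; ref-∈ = λ x → mk⇔ (ref-∉-cyclic x) λ ()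
      ; rot-0 = 0%d
      ; rot-rot = λ p q → add-0-residue (>-nonZero⁻¹ d) p q
      ; rot-neg = neg-0-residue
      ; rot-ref = λ _ () ; ref-rot = λ () ; ref-ref = λ () }

    dihedral-subgroup : ∀ j → j < d → IsSubgroup n (dihedralSub d j)
    dihedral-subgroup j j<d = described⇒subgroup record
      { InRot = λ x → x % d ≡ 0 ; InRef = λ x → x % d ≡ j
      ; rot-∈ = rot-∈-dihedral j ; ref-∈ = ref-∈-dihedral j
      ; rot-0 = 0%d
      ; rot-rot = λ p q → add-0-residue (>-nonZero⁻¹ d) p q
      ; rot-neg = neg-0-residue
      ; rot-ref = add-0-residue j<d
      ; ref-rot = sub-0-residue
      ; ref-ref = λ p q → sub-residue (trans p (sym q)) }

  -- Every subgroup S of D_n is ⟨a^d⟩ or ⟨a^d, a^j b⟩, where d is the least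
  -- positive exponent with a^d ∈ S (so d ∣ n) and j < d.
  module Classification {S : Sub n} (S-subgroup : IsSubgroup n S) where

    RotIn RefIn : ℕ → Set
    RotIn x = rot ⌊ x ⌋ ∈ˢ S
    RefIn x = ref ⌊ x ⌋ ∈ˢ S

    private
      closed-· : ∀ x y → x ∈ˢ S → y ∈ˢ S → x · y ∈ˢ S
      closed-· = proj₁ (proj₂ S-subgroup)
      closed-⁻¹ : ∀ x → x ∈ˢ S → x ⁻¹ ∈ˢ S
      closed-⁻¹ = proj₂ (proj₂ S-subgroup)

    rot-0 : RotIn 0
    rot-0 = proj₁ S-subgroup

    rot-+ : ∀ {a b} → RotIn a → RotIn b → RotIn (a + b)
    rot-+ {a} {b} pa pb = subst (_∈ˢ S) (rot·rot a b) (closed-· (rot ⌊ a ⌋) (rot ⌊ b ⌋) pa pb)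

    rot-neg : ∀ {a} → RotIn a → RotIn (neg a)
    rot-neg {a} pa = subst (_∈ˢ S) (rot⁻¹ a) (closed-⁻¹ (rot ⌊ a ⌋) pa)

    rot-* : ∀ q {a} → RotIn a → RotIn (q * a)
    rot-* zero pa = rot-0
    rot-* (suc q) pa = rot-+ pa (rot-* q pa)

    rot-≈ : ∀ {a b} → a ≈ b → RotIn a → RotIn b
    rot-≈ eq = subst (_∈ˢ S) (rot≈ eq)

    ref-≈ : ∀ {a b} → a ≈ b → RefIn a → RefIn b
    ref-≈ eq = subst (_∈ˢ S) (ref≈ eq)

    ref-ref : ∀ {a b} → RefIn a → RefIn b → RotIn (a + neg b)
    ref-ref {a} {b} qa qb = subst (_∈ˢ S) (ref·ref a b) (closed-· (ref ⌊ a ⌋) (ref ⌊ b ⌋) qa qb)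

    rot-ref : ∀ {a b} → RotIn a → RefIn b → RefIn (a + b)
    rot-ref {a} {b} pa qb = subst (_∈ˢ S) (rot·ref a b) (closed-· (rot ⌊ a ⌋) (ref ⌊ b ⌋) pa qb)

    rot-n : RotIn n
    rot-n = rot-≈ (sym n≈0) rot-0

    record LeastExponent : Set where
      field
        d : ℕ
        d>0 : 0 < d
        d∈ : RotIn d
        least : ∀ m → 0 < m → m < d → ¬ RotIn m

    -- Linear search upwards from 1; it stops at n at the latest.
    least-exponent : LeastExponent
    least-exponent = search n 1 (n≤1+n n) (>-nonZero⁻¹ n) (s≤s z≤n) none-below-1
      where
        none-below-1 : ∀ m → 0 < m → m < 1 → ¬ RotIn m
        none-below-1 m 0<m (s≤s m≤0) _ = <-irrefl refl (≤-trans 0<m m≤0)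
        search : ∀ fuel k → n ≤ k + fuel → k ≤ n → 0 < k → (∀ m → 0 < m → m < k → ¬ RotIn m) → LeastExponent
        search fuel k le k≤n k>0 below with k ≟ n
        ... | yes refl = record { d = k ; d>0 = k>0 ; d∈ = rot-n ; least = below }
        ... | no k≢n with ⌊ k ⌋ ∈? proj₁ S
        ...   | yes k∈ = record { d = k ; d>0 = k>0 ; d∈ = k∈ ; least = below }
        ...   | no k∉ with fuel
        ...     | zero = ⊥-elim (k≢n (≤-antisym k≤n (subst (n ≤_) (+-identityʳ k) le)))
        ...     | suc f = search f (suc k) (subst (n ≤_) (+-suc k f) le) (≤∧≢⇒< k≤n k≢n) (s≤s z≤n) below′
          where
            below′ : ∀ m → 0 < m → m < suc k → ¬ RotIn m
            below′ m m>0 m<sk m∈ with m ≟ k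
            ... | yes refl = k∉ m∈
            ... | no m≢k = below m m>0 (≤∧≢⇒< (≤-pred m<sk) m≢k) m∈

    open LeastExponent least-exponent public

    instance d-nonZero : NonZero d
    d-nonZero = >-nonZero d>0

    -- a^x ∈ S iff d ∣ x: otherwise x mod d would be a smaller positive exponent.
    rot-∈⇒ : ∀ x → RotIn x → x % d ≡ 0
    rot-∈⇒ x x∈ with x % d in r≡
    ... | zero = refl
    ... | suc r′ = ⊥-elim (least (suc r′) (s≤s z≤n) (subst (_< d) r≡ (m%n<n x d)) (subst RotIn r≡ (rot-≈ x-qd≈r x-qd∈)))
      where
        x-qd∈ : RotIn (x + neg ((x / d) * d))
        x-qd∈ = rot-+ x∈ (rot-neg (rot-* (x / d) d∈))
        x-qd≈r : x + neg ((x / d) * d) ≈ x % d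
        x-qd≈r = trans (≡⇒≈ (cong (_+ neg ((x / d) * d)) (m≡m%n+[m/n]*n x d))) (neg-cancelʳ′ (x % d) ((x / d) * d))

    rot-∈⇐ : ∀ x → x % d ≡ 0 → RotIn x
    rot-∈⇐ x x%d≡0 = rot-≈ (≡⇒≈ (sym (trans (m≡m%n+[m/n]*n x d) (cong (_+ (x / d) * d) x%d≡0)))) (rot-* (x / d) d∈)

    d∣n : d ∣ n
    d∣n = m%n≡0⇒n∣m n d (rot-∈⇒ n rot-n)

    open Residues d d∣n

    classify : S ≡ cyclicSub d ⊎ ∃ λ j → j < d × S ≡ dihedralSub d j
    classify with any? (λ i → i ∈? proj₂ S)
    ... | no no-ref = inj₁ (sub-ext S (cyclicSub d) ⊆C C⊆)
      where
        ⊆C : ∀ x → x ∈ˢ S → x ∈ˢ cyclicSub d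
        ⊆C x x∈ with view x
        ... | rotʳ a = from (rot-∈-cyclic a) (rot-∈⇒ a x∈)
        ... | refʳ a = ⊥-elim (no-ref (⌊ a ⌋ , x∈))
        C⊆ : ∀ x → x ∈ˢ cyclicSub d → x ∈ˢ S
        C⊆ x x∈ with view x
        ... | rotʳ a = rot-∈⇐ a (to (rot-∈-cyclic a) x∈)
        ... | refʳ a = ⊥-elim (ref-∉-cyclic a x∈)
    ... | yes (i , i∈) = inj₂ (J % d , m%n<n J d , sub-ext S (dihedralSub d (J % d)) ⊆D D⊆)
      where
        J : ℕ
        J = toℕ i
        J∈ : RefIn J
        J∈ = subst (λ w → ref w ∈ˢ S) (sym (⌊toℕ⌋ i)) i∈
        ⊆D : ∀ x → x ∈ˢ S → x ∈ˢ dihedralSub d (J % d)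
        ⊆D x x∈ with view x
        ... | rotʳ a = from (rot-∈-dihedral (J % d) a) (rot-∈⇒ a x∈)
        ... | refʳ a = from (ref-∈-dihedral (J % d) a) (sub-residue⁻ (rot-∈⇒ _ (ref-ref x∈ J∈)))
        D⊆ : ∀ x → x ∈ˢ dihedralSub d (J % d) → x ∈ˢ S
        D⊆ x x∈ with view x
        ... | rotʳ a = rot-∈⇐ a (to (rot-∈-dihedral (J % d) a) x∈)
        ... | refʳ a = ref-≈ (neg-cancelʳ a J) (rot-ref (rot-∈⇐ _ (sub-residue (to (ref-∈-dihedral (J % d) a) x∈))) J∈)

-- When do two subgroups of D_n permute?  Rotation subgroups permute with
-- everything, and conjugation by a reflection of H preserves permutability
-- with H.
module Permutability (n : ℕ) .{{_ : NonZero n}} where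
  open import Defs
  open Dihedral n
  open Subgroups n
  open import Data.Fin using (Fin)
  open import Data.Product using (Σ; _×_; _,_; proj₁; proj₂)
  open import Data.Sum using (inj₁; inj₂)
  open import Data.Unit using () renaming (⊤ to Unit)
  open import Data.Empty using () renaming (⊥ to Empty)
  open import Function.Bundles using (Equivalence)
  open import Relation.Binary.PropositionalEquality using (_≡_; sym; trans; cong; cong₂; subst; module ≡-Reasoning)
  open Equivalence using (to; from)

  IsRotation : El n → Set
  IsRotation (rot _) = Unit
  IsRotation (ref _) = Empty

  swap-by-conjugate : ∀ x k → x · k ≡ k · (k ⁻¹ · x · k)
  swap-by-conjugate x k = begin
    x · k                  ≡⟨ sym (identityˡ (x · k)) ⟩
    e · (x · k)            ≡⟨ cong (_· (x · k)) (sym (inverseʳ k)) ⟩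
    k · k ⁻¹ · (x · k)     ≡⟨ assoc k (k ⁻¹) (x · k) ⟩
    k · (k ⁻¹ · (x · k))   ≡⟨ cong (k ·_) (sym (assoc (k ⁻¹) x k)) ⟩
    k · (k ⁻¹ · x · k)     ∎
    where open ≡-Reasoning

  swap-by-conjugate′ : ∀ k x → k · x ≡ (k ⁻¹) ⁻¹ · x · k ⁻¹ · k
  swap-by-conjugate′ k x = begin
    k · x                     ≡⟨ sym (identityʳ (k · x)) ⟩
    k · x · e                 ≡⟨ cong (k · x ·_) (sym (inverseˡ k)) ⟩
    k · x · (k ⁻¹ · k)        ≡⟨ sym (assoc (k · x) (k ⁻¹) k) ⟩
    k · x · k ⁻¹ · k          ≡⟨ cong (λ w → w · x · k ⁻¹ · k) (sym (⁻¹-involutive k)) ⟩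
    (k ⁻¹) ⁻¹ · x · k ⁻¹ · k  ∎
    where open ≡-Reasoning

  module ConjugationBy (c : Fin n) where

    h : El n
    h = ref c

    h·h : h · h ≡ e
    h·h = inverseʳ h

    cancel-hʳ : ∀ x → x · h · h ≡ x
    cancel-hʳ x = trans (assoc x h h) (trans (cong (x ·_) h·h) (identityʳ x))

    cancel-hˡ : ∀ x → h · (h · x) ≡ x
    cancel-hˡ x = trans (sym (assoc h h x)) (trans (cong (_· x) h·h) (identityˡ x))

    σ : El n → El n
    σ x = h · x · h

    σ-involutive : ∀ x → σ (σ x) ≡ x
    σ-involutive x = trans (assoc h (σ x) h) (trans (cong (h ·_) (cancel-hʳ (h · x))) (cancel-hˡ x))

    σ-· : ∀ x y → σ (x · y) ≡ σ x · σ y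
    σ-· x y = sym (begin
      h · x · h · (h · y · h)   ≡⟨ sym (assoc (σ x) (h · y) h) ⟩
      h · x · h · (h · y) · h   ≡⟨ cong (_· h) (sym (assoc (σ x) h y)) ⟩
      h · x · h · h · y · h     ≡⟨ cong (λ w → w · y · h) (cancel-hʳ (h · x)) ⟩
      h · x · y · h             ≡⟨ cong (_· h) (assoc h x y) ⟩
      h · (x · y) · h           ∎)
      where open ≡-Reasoning

    σ-e : σ e ≡ e
    σ-e = trans (cong (_· h) (identityʳ h)) h·h

    σ-⁻¹ : ∀ x → σ (x ⁻¹) ≡ (σ x) ⁻¹
    σ-⁻¹ x = sym (trans (⁻¹-anti-homo-∙ (h · x) h) (trans (cong (h ·_) (⁻¹-anti-homo-∙ h x)) (sym (assoc h (x ⁻¹) h))))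

    σ-transport : ∀ {x k a b} → σ x · σ k ≡ a · b → x · k ≡ σ a · σ b
    σ-transport {x} {k} {a} {b} eq =
      trans (sym (cong₂ _·_ (σ-involutive x) (σ-involutive k))) (trans (sym (σ-· (σ x) (σ k))) (trans (cong σ eq) (σ-· a b)))

    ·h-swap : ∀ y → y · h ≡ h · σ y
    ·h-swap y = trans (sym (cancel-hˡ (y · h))) (cong (h ·_) (sym (assoc h y h)))

    ·-via-h : ∀ x k → x · k ≡ x · h · σ k · h
    ·-via-h x k = sym (begin
      x · h · σ k · h        ≡⟨ assoc (x · h) (σ k) h ⟩
      x · h · (σ k · h)      ≡⟨ cong (x · h ·_) (cancel-hʳ (h · k)) ⟩
      x · h · (h · k)        ≡⟨ assoc x h (h · k) ⟩
      x · (h · (h · k))      ≡⟨ cong (x ·_) (cancel-hˡ k) ⟩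
      x · k                  ∎)
      where open ≡-Reasoning

  Swap : Sub n → Sub n → El n → El n → Set
  Swap H K h k = Σ (El n) λ k′ → Σ (El n) λ h′ → k′ ∈ˢ K × h′ ∈ˢ H × h · k ≡ k′ · h′

  module _ {H K : Sub n} (H-subgroup : IsSubgroup n H) where

    private
      closed-· : ∀ x y → x ∈ˢ H → y ∈ˢ H → x · y ∈ˢ H
      closed-· = proj₁ (proj₂ H-subgroup)
      closed-⁻¹ : ∀ x → x ∈ˢ H → x ⁻¹ ∈ˢ H
      closed-⁻¹ = proj₂ (proj₂ H-subgroup)

    -- The rotations form a normal subgroup: conjugates of a rotation x are x or x⁻¹.
    conjugate-∈ : ∀ x k → IsRotation x → x ∈ˢ H → k ⁻¹ · x · k ∈ˢ H
    conjugate-∈ (rot i) k _ x∈ with conjugate-rot i k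
    ... | inj₁ eq = subst (_∈ˢ H) (sym eq) x∈
    ... | inj₂ eq = subst (_∈ˢ H) (sym eq) (closed-⁻¹ (rot i) x∈)

    swap-rotˡ : ∀ x k → IsRotation x → x ∈ˢ H → k ∈ˢ K → Swap H K x k
    swap-rotˡ x k r x∈ k∈ = k , k ⁻¹ · x · k , k∈ , conjugate-∈ x k r x∈ , swap-by-conjugate x k

    swap-rotʳ : ∀ k x → IsRotation x → x ∈ˢ H → k ∈ˢ K → Swap K H k x
    swap-rotʳ k x r x∈ k∈ = (k ⁻¹) ⁻¹ · x · k ⁻¹ , k , conjugate-∈ x (k ⁻¹) r x∈ , k∈ , swap-by-conjugate′ k x

    rotations-permute : (∀ x → x ∈ˢ H → IsRotation x) → Permute n H K
    rotations-permute all-rot = (λ x k x∈ k∈ → swap-rotˡ x k (all-rot x x∈) x∈ k∈)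
                              , (λ k x k∈ x∈ → swap-rotʳ k x (all-rot x x∈) x∈ k∈)

    -- If H contains the reflection h and K is normalised by h, then HK = KH:
    -- a reflection x ∈ H is (x h) h with x h a rotation of H.
    module _ (c : Fin n) (h∈ : ref c ∈ˢ H) where
      open ConjugationBy c

      normalised-permute : (∀ k → k ∈ˢ K → σ k ∈ˢ K) → Permute n H K
      normalised-permute σK = swapˡ , swapʳ
        where
          swapˡ : ProdSub n H K
          swapˡ (rot i) k x∈ k∈ = swap-rotˡ (rot i) k _ x∈ k∈
          swapˡ (ref a) k x∈ k∈ with k′ , h″ , k′∈ , h″∈ , eq ← swap-rotˡ (ref a · h) (σ k) _ (closed-· (ref a) h x∈ h∈) (σK k k∈)
            = k′ , h″ · h , k′∈ , closed-· h″ h h″∈ h∈ , trans (·-via-h (ref a) k) (trans (cong (_· h) eq) (assoc k′ h″ h))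
          swapʳ : ProdSub n K H
          swapʳ k (rot i) k∈ x∈ = swap-rotʳ k (rot i) _ x∈ k∈
          swapʳ k (ref a) k∈ x∈ with h″ , k″ , h″∈ , k″∈ , eq ← swap-rotʳ k (ref a · h) _ (closed-· (ref a) h x∈ h∈) k∈
            = h″ · h , σ k″ , closed-· h″ h h″∈ h∈ , σK k″ k″∈ , (begin
              k · ref a              ≡⟨ cong (k ·_) (sym (cancel-hʳ (ref a))) ⟩
              k · (ref a · h · h)    ≡⟨ sym (assoc k (ref a · h) h) ⟩
              k · (ref a · h) · h    ≡⟨ cong (_· h) eq ⟩
              h″ · k″ · h            ≡⟨ assoc h″ k″ h ⟩
              h″ · (k″ · h)          ≡⟨ cong (h″ ·_) (·h-swap k″) ⟩
              h″ · (h · σ k″)        ≡⟨ sym (assoc h″ h (σ k″)) ⟩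
              h″ · h · σ k″          ∎)
            where open ≡-Reasoning

  module SubsetConjugation (c : Fin n) where
    open ConjugationBy c public

    σˢ : Sub n → Sub n
    σˢ S = subsetOf (λ x → σ x ∈ˢ S) (λ x → σ x ∈ˢ? S)

    ∈-σˢ⁻ : ∀ {x S} → x ∈ˢ σˢ S → σ x ∈ˢ S
    ∈-σˢ⁻ {x} {S} = to (∈-subsetOf (λ x → σ x ∈ˢ S) (λ x → σ x ∈ˢ? S) x)

    ∈-σˢ⁺ : ∀ {x S} → σ x ∈ˢ S → x ∈ˢ σˢ S
    ∈-σˢ⁺ {x} {S} = from (∈-subsetOf (λ x → σ x ∈ˢ S) (λ x → σ x ∈ˢ? S) x)

    ∈-σˢ-σ : ∀ {x S} → x ∈ˢ S → σ x ∈ˢ σˢ S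
    ∈-σˢ-σ {x} {S} x∈ = ∈-σˢ⁺ (subst (_∈ˢ S) (sym (σ-involutive x)) x∈)

    σˢ-involutive : ∀ S → σˢ (σˢ S) ≡ S
    σˢ-involutive S = sub-ext (σˢ (σˢ S)) S
      (λ x x∈ → subst (_∈ˢ S) (σ-involutive x) (∈-σˢ⁻ (∈-σˢ⁻ x∈)))
      (λ x x∈ → ∈-σˢ⁺ (∈-σˢ-σ x∈))

    σˢ-subgroup : ∀ {S} → IsSubgroup n S → IsSubgroup n (σˢ S)
    σˢ-subgroup {S} (e∈ , closed-· , closed-⁻¹) =
      ∈-σˢ⁺ {e} {S} (subst (_∈ˢ S) (sym σ-e) e∈) ,
      (λ x y x∈ y∈ → ∈-σˢ⁺ {x · y} {S} (subst (_∈ˢ S) (sym (σ-· x y)) (closed-· _ _ (∈-σˢ⁻ {x} x∈) (∈-σˢ⁻ {y} y∈)))) ,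
      (λ x x∈ → ∈-σˢ⁺ {x ⁻¹} {S} (subst (_∈ˢ S) (sym (σ-⁻¹ x)) (closed-⁻¹ _ (∈-σˢ⁻ {x} x∈))))

    module _ {H : Sub n} (H-subgroup : IsSubgroup n H) (h∈ : h ∈ˢ H) where
      private
        closed-· : ∀ x y → x ∈ˢ H → y ∈ˢ H → x · y ∈ˢ H
        closed-· = proj₁ (proj₂ H-subgroup)

      σ-∈ : ∀ x → x ∈ˢ H → σ x ∈ˢ H
      σ-∈ x x∈ = closed-· _ _ (closed-· _ _ h∈ x∈) h∈

      σˢ-fixes : σˢ H ≡ H
      σˢ-fixes = sub-ext (σˢ H) H
        (λ x x∈ → subst (_∈ˢ H) (σ-involutive x) (σ-∈ (σ x) (∈-σˢ⁻ x∈)))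
        (λ x x∈ → ∈-σˢ⁺ (σ-∈ x x∈))

      -- σ is an automorphism fixing H, so it carries witnesses for HK = KH to
      -- witnesses for H σ(K) = σ(K) H.
      σˢ-permute : ∀ {K} → Permute n H K → Permute n H (σˢ K)
      σˢ-permute {K} (HK⊆KH , KH⊆HK) = swapˡ , swapʳ
        where
          swapˡ : ProdSub n H (σˢ K)
          swapˡ x k x∈ k∈ with k′ , h′ , k′∈ , h′∈ , eq ← HK⊆KH (σ x) (σ k) (σ-∈ x x∈) (∈-σˢ⁻ k∈) =
            σ k′ , σ h′ , ∈-σˢ-σ k′∈ , σ-∈ h′ h′∈ , σ-transport eq
          swapʳ : ProdSub n (σˢ K) H
          swapʳ k x k∈ x∈ with h′ , k′ , h′∈ , k′∈ , eq ← KH⊆HK (σ k) (σ x) (∈-σˢ⁻ k∈) (σ-∈ x x∈) =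
            σ h′ , σ k′ , σ-∈ h′ h′∈ , ∈-σˢ-σ k′∈ , σ-transport eq

      -- A subgroup fixed by σ is normalised by h, hence permutes with H.
      fixed⇒permute : ∀ {K} → σˢ K ≡ K → Permute n H K
      fixed⇒permute {K} fixed = normalised-permute H-subgroup c h∈ (λ k k∈ → ∈-σˢ⁻ (subst (k ∈ˢ_) (sym fixed) k∈))

    σˢ-trivial : σˢ (trivialSub n) ≡ trivialSub n
    σˢ-trivial = sub-ext _ _
      (λ x x∈ → ∈-trivial⁺ (trans (sym (σ-involutive x)) (trans (cong σ (∈-trivial⁻ (σ x) (∈-σˢ⁻ x∈))) σ-e)))
      (λ x x∈ → ∈-σˢ⁺ (∈-trivial⁺ (trans (cong σ (∈-trivial⁻ x x∈)) σ-e)))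

    σˢ-full : σˢ (fullSub n) ≡ fullSub n
    σˢ-full = sub-ext _ _ (λ x _ → ∈-full x) (λ x _ → ∈-σˢ⁺ (∈-full (σ x)))

-- The duplicate-free list of all subgroups of D_n, of length Σ_{d ∣ n} (1 + d).
module SubgroupList (n : ℕ) .{{_ : NonZero n}} where
  open import Defs
  open Dihedral n
  open Subgroups n
  open import Data.Nat using (suc; _+_; _<_)
  open import Data.Nat.DivMod using (m<n⇒m%n≡m; n%n≡0)
  open import Data.Nat.Divisibility using (_∣_; m%n≡0⇒n∣m; ∣-antisym)
  open import Data.Fin using (Fin; toℕ; fromℕ<)
  open import Data.Fin.Properties using (toℕ-injective; toℕ<n; toℕ-fromℕ<)
  import Data.Fin.Subset as Subset
  open import Data.List using (List; []; _∷_; length; tabulate; concatMap)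
  open import Data.List.Properties using (length-++; length-tabulate)
  open import Data.List.Membership.Propositional using (_∈_; find; lose)
  open import Data.List.Membership.Propositional.Properties using (∈-tabulate⁺; ∈-tabulate⁻; ∈-concatMap⁺; ∈-concatMap⁻)
  open import Data.List.Relation.Unary.Any using (here; there)
  open import Data.List.Relation.Unary.All as All using (All)
  open import Data.List.Relation.Unary.AllPairs using ([]; _∷_)
  open import Data.List.Relation.Unary.Unique.Propositional using (Unique)
  open import Data.List.Relation.Unary.Unique.Propositional.Properties using (++⁺; tabulate⁺)
  open import Data.Product using (_×_; _,_; proj₁)
  open import Data.Sum using (inj₁; inj₂)
  open import Relation.Nullary using (¬_)
  open import Function.Base using (_∘_)
  open import Function.Bundles using (Equivalence)
  open import Relation.Binary.PropositionalEquality using (_≡_; _≢_; refl; sym; trans; cong; cong₂; subst)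
  open Equivalence using (to; from)
  open Divisors using (divisors; divisors-unique; ∈-divisors⁺; ∈-divisors⁻; divisor-nonZero)
  open DivisorSum using (sum1+)

  dihedralSubs : ℕ → List (Sub n)
  dihedralSubs d = tabulate (λ (j : Fin d) → dihedralSub d (toℕ j))

  ∈-dihedralSubs : ∀ {d j} → j < d → dihedralSub d j ∈ dihedralSubs d
  ∈-dihedralSubs {d} j<d = subst (_∈ dihedralSubs d) (cong (dihedralSub d) (toℕ-fromℕ< j<d))
    (∈-tabulate⁺ {f = λ (j : Fin d) → dihedralSub d (toℕ j)} (fromℕ< j<d))

  block : ℕ → List (Sub n)
  block d = cyclicSub d ∷ dihedralSubs d

  subgroups : List (Sub n)
  subgroups = concatMap block (divisors n)

  subgroup⇒∈ : ∀ S → IsSubgroup n S → S ∈ subgroups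
  subgroup⇒∈ S S-subgroup = ∈-concatMap⁺ block {xs = divisors n} (lose (∈-divisors⁺ {n} d∣n) in-block)
    where
      open Classification S-subgroup
      in-block : S ∈ block d
      in-block with classify
      ... | inj₁ S≡C = here S≡C
      ... | inj₂ (j , j<d , S≡D) = there (subst (_∈ dihedralSubs d) (sym S≡D) (∈-dihedralSubs j<d))

  ∈⇒subgroup : ∀ S → S ∈ subgroups → IsSubgroup n S
  ∈⇒subgroup S S∈ with d , d∈ , S∈block ← find (∈-concatMap⁻ block {xs = divisors n} S∈) = in-block S∈block
    where
      d∣n : d ∣ n
      d∣n = ∈-divisors⁻ {n} d∈
      instance d-nonZero : NonZero d
      d-nonZero = divisor-nonZero d∣n
      open Residues d d∣n
      in-block : S ∈ block d → IsSubgroup n S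
      in-block (here refl) = cyclic-subgroup
      in-block (there p) with j , refl ← ∈-tabulate⁻ p = dihedral-subgroup (toℕ j) (toℕ<n j)

  module _ (d : ℕ) .{{_ : NonZero d}} (d∣n : d ∣ n) where
    open Residues d d∣n

    private
      ref-j∈ : ∀ (j : Fin d) → ref ⌊ toℕ j ⌋ ∈ˢ dihedralSub d (toℕ j)
      ref-j∈ j = from (ref-∈-dihedral (toℕ j) (toℕ j)) (m<n⇒m%n≡m (toℕ<n j))

    block-unique : Unique (block d)
    block-unique = All.tabulate cyclic≢dihedral ∷ tabulate⁺ dihedral-injective
      where
        cyclic≢dihedral : ∀ {S} → S ∈ dihedralSubs d → cyclicSub d ≢ S
        cyclic≢dihedral p C≡S with j , refl ← ∈-tabulate⁻ p = ref-∉-cyclic (toℕ j) (subst (ref ⌊ toℕ j ⌋ ∈ˢ_) (sym C≡S) (ref-j∈ j))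
        dihedral-injective : ∀ {j j′ : Fin d} → dihedralSub d (toℕ j) ≡ dihedralSub d (toℕ j′) → j ≡ j′
        dihedral-injective {j} {j′} D≡D′ = toℕ-injective (trans (sym (m<n⇒m%n≡m (toℕ<n j)))
          (to (ref-∈-dihedral (toℕ j′) (toℕ j)) (subst (ref ⌊ toℕ j ⌋ ∈ˢ_) D≡D′ (ref-j∈ j))))

  -- All members of block d have rotation part ⟨a^d⟩, which determines d.
  block-rotations : ∀ d {S} → S ∈ block d → proj₁ S ≡ proj₁ (cyclicSub d)
  block-rotations d (here refl) = refl
  block-rotations d (there p) with j , refl ← ∈-tabulate⁻ p = refl

  rotations-determine-divisor : ∀ {d d′} → d ∣ n → d′ ∣ n → proj₁ (cyclicSub d) ≡ proj₁ (cyclicSub d′) → d ≡ d′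
  rotations-determine-divisor {d} {d′} d∣n d′∣n eq = ∣-antisym (divides d d′ d∣n d′∣n eq) (divides d′ d d′∣n d∣n (sym eq))
    where
      divides : ∀ d d′ → d ∣ n → d′ ∣ n → proj₁ (cyclicSub d) ≡ proj₁ (cyclicSub d′) → d ∣ d′
      divides d d′ d∣n d′∣n eq = m%n≡0⇒n∣m d′ d (to (Residues.rot-∈-cyclic d d∣n d′)
          (subst (λ R → ⌊ d′ ⌋ Subset.∈ R) (sym eq) (from (Residues.rot-∈-cyclic d′ d′∣n d′) (n%n≡0 d′))))
        where
          instance d-nonZero : NonZero d
          d-nonZero = divisor-nonZero d∣n
          instance d′-nonZero : NonZero d′
          d′-nonZero = divisor-nonZero d′∣n

  -- Blocks of distinct divisors are disjoint, so the list has no duplicates.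
  subgroups-unique : Unique subgroups
  subgroups-unique = go (divisors n) (divisors-unique n) ∈-divisors⁻
    where
      go : ∀ ds → Unique ds → (∀ {d} → d ∈ ds → d ∣ n) → Unique (concatMap block ds)
      go [] _ _ = []
      go (d ∷ ds) (d∉ds ∷ u) divs = ++⁺ (block-unique d {{divisor-nonZero d∣n}} d∣n) (go ds u (divs ∘ there)) disjoint
        where
          d∣n : d ∣ n
          d∣n = divs (here refl)
          disjoint : ∀ {S} → ¬ (S ∈ block d × S ∈ concatMap block ds)
          disjoint (p , q) with d′ , d′∈ , q′ ← find (∈-concatMap⁻ block {xs = ds} q) =
            All.lookup d∉ds d′∈ (rotations-determine-divisor d∣n (divs (there d′∈))
              (trans (sym (block-rotations d p)) (block-rotations d′ q′)))

  length-subgroups : length subgroups ≡ sum1+ (divisors n)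
  length-subgroups = go (divisors n)
    where
      go : ∀ ds → length (concatMap block ds) ≡ sum1+ ds
      go [] = refl
      go (d ∷ ds) = trans (length-++ (block d)) (cong₂ _+_ (cong suc (length-tabulate _)) (go ds))

-- Degrees in Γ(D_n): every vertex has degree ≡ #subgroups + 1 (mod 2).
module Degrees (n : ℕ) .{{_ : NonZero n}} where
  open import Defs
  open Dihedral n
  open Subgroups n
  open Permutability n
  open SubgroupList n
  open import Data.Nat using (_+_; _≤_; >-nonZero⁻¹)
  open import Data.Nat.DivMod using (m<n⇒m%n≡m; n%1≡0)
  open import Data.Nat.Divisibility using (1∣_)
  open import Data.Bool using (true; false; not; _xor_)
  open import Data.Bool.Properties using (not-involutive) renaming (_≟_ to _≟ᵇ_)
  open import Data.Fin.Properties using (all?; any?) renaming (_≟_ to _≟ᶠ_)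
  open import Data.List using (List; []; _∷_; length; filter)
  open import Data.List.Membership.Propositional using (_∈_)
  open import Data.List.Membership.Propositional.Properties using (∈-filter⁺; ∈-filter⁻)
  open import Data.List.Relation.Unary.Any using (here; there)
  open import Data.List.Relation.Unary.All using ([]; _∷_)
  open import Data.List.Relation.Unary.AllPairs using ([]; _∷_)
  open import Data.List.Relation.Unary.Unique.Propositional using (Unique)
  open import Data.List.Relation.Unary.Unique.Propositional.Properties using (filter⁺)
  import Data.Vec.Properties as Vec
  import Data.Product.Properties as Product
  open import Data.Product using (Σ; _×_; _,_; proj₁; proj₂)
  open import Data.Empty using (⊥-elim)
  open import Function.Bundles using (_⇔_; mk⇔; Equivalence)
  open import Relation.Nullary using (¬_; Dec; yes; no; ¬?)
  open import Function.Base using (_∘_)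
  open import Data.Fin.Subset.Properties using (_∈?_)
  open import Relation.Nullary.Decidable using (_×-dec_; _→-dec_)
  open import Relation.Binary using (DecidableEquality)
  open import Relation.Binary.PropositionalEquality using (_≡_; _≢_; refl; sym; trans; cong; cong₂; subst; module ≡-Reasoning)
  open Equivalence using (to; from)
  open Parity using (parity; parity-+; 2∣⇒even; even⇒2∣)
  open DistinctLists using (same-length; length-partition; pairs-off⇒even)
  open DivisorSum using (sum1+)
  open Divisors using (divisors)

  -- Permutability is decidable, D_n being finite.

  infix 4 _≟ᴱ_
  _≟ᴱ_ : DecidableEquality (El n)
  rot i ≟ᴱ rot j with i ≟ᶠ j
  ... | yes refl = yes refl
  ... | no i≢j = no λ { refl → i≢j refl }
  rot i ≟ᴱ ref j = no λ ()
  ref i ≟ᴱ rot j = no λ ()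
  ref i ≟ᴱ ref j with i ≟ᶠ j
  ... | yes refl = yes refl
  ... | no i≢j = no λ { refl → i≢j refl }

  _≟ˢ_ : DecidableEquality (Sub n)
  _≟ˢ_ = Product.≡-dec (Vec.≡-dec _≟ᵇ_) (Vec.≡-dec _≟ᵇ_)

  all-El? : ∀ {P : El n → Set} → (∀ x → Dec (P x)) → Dec (∀ x → P x)
  all-El? P? with all? (λ i → P? (rot i)) | all? (λ i → P? (ref i))
  ... | yes on-rot | yes on-ref = yes λ { (rot i) → on-rot i ; (ref i) → on-ref i }
  ... | no ¬on-rot | _ = no λ all → ¬on-rot (λ i → all (rot i))
  ... | yes _ | no ¬on-ref = no λ all → ¬on-ref (λ i → all (ref i))

  any-El? : ∀ {P : El n → Set} → (∀ x → Dec (P x)) → Dec (Σ (El n) P)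
  any-El? P? with any? (λ i → P? (rot i)) | any? (λ i → P? (ref i))
  ... | yes (i , p) | _ = yes (rot i , p)
  ... | no _ | yes (i , p) = yes (ref i , p)
  ... | no ¬at-rot | no ¬at-ref = no λ { (rot i , p) → ¬at-rot (i , p) ; (ref i , p) → ¬at-ref (i , p) }

  permute? : ∀ H K → Dec (Permute n H K)
  permute? H K = ⊆? H K ×-dec ⊆? K H
    where
      ⊆? : ∀ H K → Dec (ProdSub n H K)
      ⊆? H K = all-El? λ h → all-El? λ k → (h ∈ˢ? H) →-dec ((k ∈ˢ? K) →-dec
        any-El? λ k′ → any-El? λ h′ → (k′ ∈ˢ? K) ×-dec (h′ ∈ˢ? H) ×-dec (h · k ≟ᴱ k′ · h′))

  OtherVertex : Sub n → Sub n → Set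
  OtherVertex H K = K ≢ trivialSub n × K ≢ fullSub n × K ≢ H

  otherVertex? : ∀ H K → Dec (OtherVertex H K)
  otherVertex? H K = ¬? (K ≟ˢ trivialSub n) ×-dec ¬? (K ≟ˢ fullSub n) ×-dec ¬? (K ≟ˢ H)

  -- The subgroups split into {1, D_n, H}, the neighbours of H and the
  -- remaining vertices, which do not permute with H.
  others neighbours strangers excluded : Sub n → List (Sub n)
  others H = filter (otherVertex? H) subgroups
  neighbours H = filter (permute? H) (others H)
  strangers H = filter (λ K → ¬? (permute? H K)) (others H)
  excluded H = filter (λ K → ¬? (otherVertex? H K)) subgroups

  module Neighbourhood {H : Sub n} (H-vertex : Vertex n H) where
    private
      H-subgroup : IsSubgroup n H
      H-subgroup = proj₁ H-vertex
      H≢1 : H ≢ trivialSub n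
      H≢1 = proj₁ (proj₂ H-vertex)
      H≢G : H ≢ fullSub n
      H≢G = proj₂ (proj₂ H-vertex)

    others-unique : Unique (others H)
    others-unique = filter⁺ (otherVertex? H) subgroups-unique

    neighbours-unique : Unique (neighbours H)
    neighbours-unique = filter⁺ (permute? H) others-unique

    ∈-others⁻ : ∀ {K} → K ∈ others H → IsSubgroup n K × OtherVertex H K
    ∈-others⁻ {K} p with K∈ , other ← ∈-filter⁻ (otherVertex? H) {xs = subgroups} p = ∈⇒subgroup K K∈ , other

    ∈-neighbours⁻ : ∀ {K} → K ∈ neighbours H → Adjacent n H K
    ∈-neighbours⁻ {K} p with K∈ , perm ← ∈-filter⁻ (permute? H) {xs = others H} p
                        with K-subgroup , (K≢1 , K≢G , K≢H) ← ∈-others⁻ K∈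
      = H-vertex , (K-subgroup , K≢1 , K≢G) , (λ H≡K → K≢H (sym H≡K)) , perm

    ∈-neighbours⁺ : ∀ {K} → Adjacent n H K → K ∈ neighbours H
    ∈-neighbours⁺ {K} (_ , (K-subgroup , K≢1 , K≢G) , H≢K , perm) =
      ∈-filter⁺ (permute? H) (∈-filter⁺ (otherVertex? H) (subgroup⇒∈ K K-subgroup) (K≢1 , K≢G , λ K≡H → H≢K (sym K≡H))) perm

    ∈-strangers⁻ : ∀ {K} → K ∈ strangers H → IsSubgroup n K × OtherVertex H K × ¬ Permute n H K
    ∈-strangers⁻ {K} p with K∈ , ¬perm ← ∈-filter⁻ (λ K → ¬? (permute? H K)) {xs = others H} p
                       with K-subgroup , other ← ∈-others⁻ K∈ = K-subgroup , other , ¬perm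

    ∈-strangers⁺ : ∀ {K} → IsSubgroup n K → OtherVertex H K → ¬ Permute n H K → K ∈ strangers H
    ∈-strangers⁺ {K} K-subgroup other ¬perm =
      ∈-filter⁺ (λ K → ¬? (permute? H K)) (∈-filter⁺ (otherVertex? H) (subgroup⇒∈ K K-subgroup) other) ¬perm

    has-degree : HasDegree n H (length (neighbours H))
    has-degree = neighbours H , neighbours-unique , refl , λ K → mk⇔ ∈-neighbours⁻ ∈-neighbours⁺

    degree-unique : ∀ d → HasDegree n H d → d ≡ length (neighbours H)
    degree-unique d (L , L-unique , refl , ∈L⇔) =
      same-length L-unique neighbours-unique (∈-neighbours⁺ ∘ to (∈L⇔ _)) (from (∈L⇔ _) ∘ ∈-neighbours⁻)

    excluded-length : length (excluded H) ≡ 3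
    excluded-length = same-length (filter⁺ (λ K → ¬? (otherVertex? H K)) subgroups-unique) distinct ⊆three three⊆
      where
        distinct : Unique (trivialSub n ∷ fullSub n ∷ H ∷ [])
        distinct = (trivial≢full ∷ (λ 1≡H → H≢1 (sym 1≡H)) ∷ []) ∷ ((λ G≡H → H≢G (sym G≡H)) ∷ []) ∷ [] ∷ []
        ⊆three : ∀ {K} → K ∈ excluded H → K ∈ trivialSub n ∷ fullSub n ∷ H ∷ []
        ⊆three {K} p with K ≟ˢ trivialSub n | K ≟ˢ fullSub n | K ≟ˢ H
        ... | yes K≡1 | _ | _ = here K≡1
        ... | no _ | yes K≡G | _ = there (here K≡G)
        ... | no _ | no _ | yes K≡H = there (there (here K≡H))
        ... | no K≢1 | no K≢G | no K≢H =
          ⊥-elim (proj₂ (∈-filter⁻ (λ K → ¬? (otherVertex? H K)) {xs = subgroups} p) (K≢1 , K≢G , K≢H))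
        excluded⁺ : ∀ {K} → IsSubgroup n K → ¬ OtherVertex H K → K ∈ excluded H
        excluded⁺ {K} K-subgroup = ∈-filter⁺ (λ K → ¬? (otherVertex? H K)) (subgroup⇒∈ K K-subgroup)
        three⊆ : ∀ {K} → K ∈ trivialSub n ∷ fullSub n ∷ H ∷ [] → K ∈ excluded H
        three⊆ (here refl) = excluded⁺ trivial-subgroup λ (K≢1 , _) → K≢1 refl
        three⊆ (there (here refl)) = excluded⁺ full-subgroup λ (_ , K≢G , _) → K≢G refl
        three⊆ (there (there (here refl))) = excluded⁺ H-subgroup λ (_ , _ , K≢H) → K≢H refl

    -- There is an even number of vertices not permuting with H: none if H
    -- consists of rotations; otherwise conjugation by a reflection h ∈ H pairs
    -- them off, since a subgroup fixed by it permutes with H.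
    strangers-even : parity (length (strangers H)) ≡ false
    strangers-even with any? (λ i → i ∈? proj₂ H)
    ... | no no-ref = cong parity (same-length (filter⁺ (λ K → ¬? (permute? H K)) others-unique) []
            (λ p → ⊥-elim (proj₂ (proj₂ (∈-strangers⁻ p)) (rotations-permute H-subgroup all-rot))) λ ())
      where
        all-rot : ∀ x → x ∈ˢ H → IsRotation x
        all-rot (rot i) _ = _
        all-rot (ref i) i∈ = ⊥-elim (no-ref (i , i∈))
    ... | yes (c , h∈) = pairs-off⇒even σˢ (strangers H) (filter⁺ (λ K → ¬? (permute? H K)) others-unique) record
        { involutive = λ {K} _ → σˢ-involutive K
        ; closed = closed
        ; no-fixed = λ p σK≡K → proj₂ (proj₂ (∈-strangers⁻ p)) (fixed⇒permute H-subgroup h∈ σK≡K) }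
      where
        open SubsetConjugation c
        moves : ∀ {K} (F : Sub n) → σˢ F ≡ F → K ≢ F → σˢ K ≢ F
        moves {K} F fixed K≢F σK≡F = K≢F (trans (sym (σˢ-involutive K)) (trans (cong σˢ σK≡F) fixed))
        closed : ∀ {K} → K ∈ strangers H → σˢ K ∈ strangers H
        closed p with K-subgroup , (K≢1 , K≢G , K≢H) , ¬perm ← ∈-strangers⁻ p =
          ∈-strangers⁺ (σˢ-subgroup K-subgroup)
            (moves _ σˢ-trivial K≢1 , moves _ σˢ-full K≢G , moves H (σˢ-fixes H-subgroup h∈) K≢H)
            (λ perm → ¬perm (subst (Permute n H) (σˢ-involutive _) (σˢ-permute H-subgroup h∈ perm)))

    -- Hence deg H ≡ |subgroups| - 3 ≡ |subgroups| + 1 (mod 2).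
    degree-parity : parity (length (neighbours H)) ≡ not (parity (sum1+ (divisors n)))
    degree-parity = begin
      parity N                             ≡⟨ flip (parity N) ⟩
      not ((parity N xor false) xor true)  ≡⟨ cong (λ b → not ((parity N xor b) xor true)) (sym strangers-even) ⟩
      not ((parity N xor parity S) xor true) ≡⟨ cong (λ b → not (b xor true)) (sym (parity-+ N S)) ⟩
      not (parity (N + S) xor parity 3)    ≡⟨ cong not (sym (parity-+ (N + S) 3)) ⟩
      not (parity (N + S + 3))             ≡⟨ cong (not ∘ parity) (sym total) ⟩
      not (parity (length subgroups))      ≡⟨ cong (not ∘ parity) length-subgroups ⟩
      not (parity (sum1+ (divisors n)))    ∎
      where
        open ≡-Reasoning
        N S : ℕ
        N = length (neighbours H)
        S = length (strangers H)
        flip : ∀ b → b ≡ not ((b xor false) xor true)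
        flip true = refl
        flip false = refl
        total : length subgroups ≡ N + S + 3
        total = begin
          length subgroups                            ≡⟨ sym (length-partition (otherVertex? H) subgroups) ⟩
          length (others H) + length (excluded H)     ≡⟨ cong₂ _+_ (sym (length-partition (permute? H) (others H))) excluded-length ⟩
          N + S + 3                                   ∎

  rotation-vertex : 2 ≤ n → Vertex n (cyclicSub 1)
  rotation-vertex 2≤n = cyclic-subgroup , ⟨a⟩≢1 , ⟨a⟩≢G
    where
      open Residues 1 (1∣ n)
      -- a ∈ ⟨a⟩ and a ≠ 1 as n ≥ 2; a b ∉ ⟨a⟩
      ⟨a⟩≢1 : cyclicSub 1 ≢ trivialSub n
      ⟨a⟩≢1 eq = 1≢0 (trans (sym (m<n⇒m%n≡m 2≤n))
        (trans (≈-⌊⌋ (rot-injective (∈-trivial⁻ _ (subst (rot ⌊ 1 ⌋ ∈ˢ_) eq (from (rot-∈-cyclic 1) (n%1≡0 1))))))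
               (m<n⇒m%n≡m (>-nonZero⁻¹ n))))
        where
          1≢0 : 1 ≢ 0
          1≢0 ()
          rot-injective : ∀ {i j} → rot {n} i ≡ rot j → i ≡ j
          rot-injective refl = refl
      ⟨a⟩≢G : cyclicSub 1 ≢ fullSub n
      ⟨a⟩≢G eq = ref-∉-cyclic 0 (subst (ref ⌊ 0 ⌋ ∈ˢ_) (sym eq) (∈-full (ref ⌊ 0 ⌋)))

  -- Γ(D_n) is Eulerian iff D_n has an odd number of subgroups: all vertices
  -- have the same degree parity.
  eulerian⇔ : 2 ≤ n → Eulerian n ⇔ (parity (sum1+ (divisors n)) ≡ true)
  eulerian⇔ 2≤n = mk⇔ ⇒ ⇐
    where
      ⇒ : Eulerian n → parity (sum1+ (divisors n)) ≡ true
      ⇒ eulerian with d , deg , 2∣d ← eulerian (cyclicSub 1) (rotation-vertex 2≤n) = odd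
        where
          open Neighbourhood (rotation-vertex 2≤n)
          not-odd : not (parity (sum1+ (divisors n))) ≡ false
          not-odd = trans (sym degree-parity) (trans (cong parity (sym (degree-unique d deg))) (2∣⇒even 2∣d))
          odd : parity (sum1+ (divisors n)) ≡ true
          odd = trans (sym (not-involutive _)) (cong not not-odd)
      ⇐ : parity (sum1+ (divisors n)) ≡ true → Eulerian n
      ⇐ odd H H-vertex = length (neighbours H) , has-degree , even⇒2∣ _ (trans degree-parity (cong not odd))
        where open Neighbourhood H-vertex

open Parity using (parity; ¬2∣⇒odd; odd⇒¬2∣; ¬2∣⇒nonZero)
open Divisors using (Square; square?; divisors)
open Valuations using (square⇒even-valuations; even-valuations⇒square)
open DivisorSum using (sum1+; sum1+-divisors-parity)
open Degrees using (eulerian⇔)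

∧-does : ∀ {P : Set} b (P? : Dec P) → (b ∧ does P? ≡ true) ⇔ (b ≡ true × P)
∧-does true (yes p) = mk⇔ (λ _ → refl , p) (λ _ → refl)
∧-does true (no ¬p) = mk⇔ (λ ()) (λ (_ , p) → ⊥-elim (¬p p))
∧-does false P? = mk⇔ (λ ()) (λ ())

eulerian⇔odd×square : (n : ℕ) .{{_ : NonZero n}} → 2 ≤ n → ∀ α n' → ¬ (2 ∣ n') → n ≡ 2 ^ α * n' →
  Eulerian n ⇔ (parity α ≡ true × Square n')
eulerian⇔odd×square n 2≤n α n' n'-odd refl = mk⇔
  (to (∧-does (parity α) (square? n')) ∘ trans (sym count) ∘ to (eulerian⇔ n 2≤n))
  (from (eulerian⇔ n 2≤n) ∘ trans count ∘ from (∧-does (parity α) (square? n')))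
  where
    instance n'-nonZero : NonZero n'
    n'-nonZero = ¬2∣⇒nonZero n'-odd
    count : parity (sum1+ (divisors (2 ^ α * n'))) ≡ parity α ∧ does (square? n')
    count = sum1+-divisors-parity α n' (¬2∣⇒odd n' n'-odd)

corollary4p6 : (n : ℕ) .{{_ : NonZero n}} → 3 ≤ n →
    (¬ (2 ∣ n) → ¬ Eulerian n)
    × (∀ α → 2 ≤ α → n ≡ 2 ^ α → (Eulerian n ⇔ (¬ (2 ∣ α))))
    × (∀ α n' → 1 ≤ α → ¬ (2 ∣ n') → n ≡ 2 ^ α * n' →
         (Eulerian n ⇔ (¬ (2 ∣ α)
                        × (∀ p e → Prime p → p ^ e ∣ n' → ¬ (p ^ suc e ∣ n') → 2 ∣ e))))
corollary4p6 n 3≤n = odd-case , power-of-2-case , general-case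
  where
    2≤n : 2 ≤ n
    2≤n = ≤-trans (s≤s (s≤s z≤n)) 3≤n
    -- n = 2^0 n, and 0 is even
    odd-case : ¬ (2 ∣ n) → ¬ Eulerian n
    odd-case n-odd eulerian with () ← proj₁ (to (eulerian⇔odd×square n 2≤n 0 n n-odd (sym (*-identityˡ n))) eulerian)
    -- n = 2^α · 1, and 1 is a square
    power-of-2-case : ∀ α → 2 ≤ α → n ≡ 2 ^ α → (Eulerian n ⇔ (¬ (2 ∣ α)))
    power-of-2-case α _ n≡2^α = mk⇔ (odd⇒¬2∣ ∘ proj₁ ∘ to criterion) (λ α-odd → from criterion (¬2∣⇒odd α α-odd , 1 , refl))
      where
        criterion : Eulerian n ⇔ (parity α ≡ true × Square 1)
        criterion = eulerian⇔odd×square n 2≤n α 1 (odd⇒¬2∣ refl) (trans n≡2^α (sym (*-identityʳ (2 ^ α))))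
    -- n' is a square iff all its prime exponents are even
    general-case : ∀ α n' → 1 ≤ α → ¬ (2 ∣ n') → n ≡ 2 ^ α * n' →
      (Eulerian n ⇔ (¬ (2 ∣ α) × (∀ p e → Prime p → p ^ e ∣ n' → ¬ (p ^ suc e ∣ n') → 2 ∣ e)))
    general-case α n' _ n'-odd n≡ = mk⇔
      (λ eulerian → let (α-odd , square) = to criterion eulerian in odd⇒¬2∣ α-odd , square⇒even-valuations n' square)
      (λ (α-odd , even) → from criterion (¬2∣⇒odd α α-odd , even-valuations⇒square n' even))
      where
        criterion : Eulerian n ⇔ (parity α ≡ true × Square n')
        criterion = eulerian⇔odd×square n 2≤n α n' n'-odd n≡
        instance n'-nonZero : NonZero n'
        n'-nonZero = ¬2∣⇒nonZero n'-odd
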